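{- Let $\mathcal{M}$ be a $q$-matroid on $\mathcal{E}=\mathbb{F}_q^n$ and let $U$ be a $q$-cycle of the dual $q$-matroid $\mathcal{M}^*$. Then the following four posets, each ordered by inclusion, are isomorphic: (1) the sublattice of $q$-cycles of $\mathcal{M}^*$ contained in $U$; (2) the lattice of $q$-cycles of $\mathcal{M}_U^*$; (3) the lattice of cycles of $Cl(\mathcal{M}_U)^*$; (4) the sublattice of cycles of $Cl(\mathcal{M})^*$ contained in the cycle $R(U)=P(\mathcal{E})\setminus P(U^\perp)$.
   Context: A $q$-matroid is $(\mathcal{E},\rho)$ with $\rho$ on $\mathbb{F}_q$-subspaces, $0\le\rho(X)\le\dim X$, monotone, $\rho(X+Y)+\rho(X\cap Y)\le\rho(X)+\rho(Y)$. Dual: $\rho^*(X)=\dim X+\rho(X^\perp)-\rho(\mathcal{E})$ ($X^\perp$ for the standard dot product), nullity $\eta^*(X)=\dim X-\rho^*(X)$; a $q$-cycle of $\mathcal{M}^*$ of nullity $i$ is a subspace minimal under inclusion among subspaces of nullity $i$. For a subspace $U$ of dimension $s$, identify $U$ with $\mathbb{F}_q^s$ via a fixed basis and its dot product; $\mathcal{M}_U$ is the $q$-matroid on $U$ whose dual $\mathcal{M}_U^*$ has nullity $\eta_U^*(V)=\eta^*(V)$ for all subspaces $V\subseteq U$. $P(W)$ is the set of $1$-dimensional subspaces of $W$; $Cl(\mathcal{M})$ is the matroid on $P(\mathcal{E})$ with rank $S\mapsto\rho(\langle S\rangle)$ (similarly $Cl(\mathcal{M}_U)$ on $P(U)$).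 For a matroid $(E,\mathbf{r})$: dual rank $\mathbf{r}^*(Y)=|Y|+\mathbf{r}(E\setminus Y)-\mathbf{r}(E)$, nullity $\mathbf{n}(Y)=|Y|-\mathbf{r}(Y)$, and a cycle of nullity $i$ is a subset minimal among subsets of nullity $i$. -}

module Defs where

open import Data.Nat using (ℕ; zero; suc; _≤_; _∸_; _^_; _≡ᵇ_) renaming (_+_ to _+ℕ_)
open import Data.Bool using (Bool; true; false; not; _∧_; _∨_; if_then_else_)
open import Data.List using (List; []; _∷_; length; map; filterᵇ; foldr; upTo; cartesianProductWith; zipWith)
open import Data.Bool.ListAction using (any; all)
open import Data.List.Membership.Propositional using (_∈_)
open import Data.List.Relation.Unary.Unique.Propositional using (Unique)
open import Data.Vec using (Vec; []; _∷_; replicate; toList)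
import Data.Vec as Vec
open import Data.Vec.Properties using (≡-dec)
open import Data.Product using (Σ; ∃; _×_; _,_; proj₁)
open import Relation.Binary.PropositionalEquality using (_≡_; _≢_)
open import Relation.Binary.Definitions using (DecidableEquality)
open import Relation.Nullary using (¬_)
open import Relation.Nullary.Decidable using (⌊_⌋)
open import Algebra.Core using (Op₁; Op₂)
open import Algebra.Structures using (IsCommutativeRing)

record FiniteField : Set₁ where
  field
    Carrier  : Set
    _+_      : Op₂ Carrier
    _*_      : Op₂ Carrier
    -_       : Op₁ Carrier
    0#       : Carrier
    1#       : Carrier
    isCommutativeRing : IsCommutativeRing _≡_ _+_ _*_ -_ 0# 1#
    0≢1      : 0# ≢ 1#
    inverse  : ∀ x → x ≢ 0# → ∃ λ y → x * y ≡ 1#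
    _≟_      : DecidableEquality Carrier
    elements : List Carrier
    complete : ∀ x → x ∈ elements
    unique   : Unique elements

  q : ℕ
  q = length elements

-- Generic finite posets and order isomorphisms (posets are given by a
-- preorder; equality of elements is mutual ≤, i.e. antisymmetric quotient).

record Poset' : Set₁ where
  field
    Carrier : Set
    _⊑_     : Carrier → Carrier → Set

record OrderIso (P Q : Poset') : Set where
  module P = Poset' P
  module Q = Poset' Q
  field
    to      : P.Carrier → Q.Carrier
    from    : Q.Carrier → P.Carrier
    to-mono : ∀ x y → x P.⊑ y → to x Q.⊑ to y
    to-refl : ∀ x y → to x Q.⊑ to y → x P.⊑ y
    from-to : ∀ x → (from (to x) P.⊑ x) × (x P.⊑ from (to x))
    to-from : ∀ y → (to (from y) Q.⊑ y) × (y Q.⊑ to (from y))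

-- Finite matroids on a ground list G, subsets given as Boolean predicates
-- (only their values on G matter).

module FinMatroid {A : Set} (G : List A) (r : (A → Bool) → ℕ) where

  card : (A → Bool) → ℕ
  card Y = length (filterᵇ Y G)

  _⊆G_ : (A → Bool) → (A → Bool) → Set
  Y ⊆G Z = ∀ a → a ∈ G → Y a ≡ true → Z a ≡ true

  _⊂G_ : (A → Bool) → (A → Bool) → Set
  Y ⊂G Z = (Y ⊆G Z) × ¬ (Z ⊆G Y)

  rank* : (A → Bool) → ℕ
  rank* Y = (card Y +ℕ r (λ a → not (Y a))) ∸ r (λ _ → true)

  nullity* : (A → Bool) → ℕ
  nullity* Y = card Y ∸ rank* Y

  IsCycleDualOfNullity : ℕ → (A → Bool) → Set
  IsCycleDualOfNullity i Y = (nullity* Y ≡ i) × (∀ Z → Z ⊂G Y → nullity* Z ≢ i)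

  IsCycleDual : (A → Bool) → Set
  IsCycleDual Y = ∃ λ i → IsCycleDualOfNullity i Y

module Over (F : FiniteField) where
  open FiniteField F

  Vecq : ℕ → Set
  Vecq n = Vec Carrier n

  Pred : ℕ → Set
  Pred n = Vecq n → Bool

  allVecs : (n : ℕ) → List (Vecq n)
  allVecs zero    = [] ∷ []
  allVecs (suc n) = cartesianProductWith _∷_ elements (allVecs n)

  zeroV : ∀ {n} → Vecq n
  zeroV = replicate _ 0#

  _+ᵥ_ : ∀ {n} → Vecq n → Vecq n → Vecq n
  _+ᵥ_ = Vec.zipWith _+_

  _-ᵥ_ : ∀ {n} → Vecq n → Vecq n → Vecq n
  u -ᵥ v = u +ᵥ Vec.map -_ v

  _·ᵥ_ : ∀ {n} → Carrier → Vecq n → Vecq n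
  a ·ᵥ v = Vec.map (a *_) v

  dot : ∀ {n} → Vecq n → Vecq n → Carrier
  dot u v = Vec.foldr _ _+_ 0# (Vec.zipWith _*_ u v)

  eqᵇ : Carrier → Carrier → Bool
  eqᵇ a b = ⌊ a ≟ b ⌋

  eqVᵇ : ∀ {n} → Vecq n → Vecq n → Bool
  eqVᵇ u v = ⌊ ≡-dec _≟_ u v ⌋

  IsSubspace : ∀ {n} → Pred n → Set
  IsSubspace X = (X zeroV ≡ true)
               × (∀ u v → X u ≡ true → X v ≡ true → X (u +ᵥ v) ≡ true)
               × (∀ a v → X v ≡ true → X (a ·ᵥ v) ≡ true)

  _⊆_ : ∀ {n} → Pred n → Pred n → Set
  X ⊆ Y = ∀ v → X v ≡ true → Y v ≡ true

  _⊂_ : ∀ {n} → Pred n → Pred n → Set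
  X ⊂ Y = (X ⊆ Y) × ¬ (Y ⊆ X)

  _≐_ : ∀ {n} → Pred n → Pred n → Set
  X ≐ Y = (X ⊆ Y) × (Y ⊆ X)

  full : ∀ {n} → Pred n
  full _ = true

  _∩_ : ∀ {n} → Pred n → Pred n → Pred n
  (X ∩ Y) v = X v ∧ Y v

  _⊕_ : ∀ {n} → Pred n → Pred n → Pred n
  _⊕_ {n} X Y v = any (λ x → X x ∧ Y (v -ᵥ x)) (allVecs n)

  perp : ∀ {n} → Pred n → Pred n
  perp {n} X v = all (λ w → not (X w) ∨ eqᵇ (dot v w) 0#) (allVecs n)

  count : ∀ {n} → Pred n → ℕ
  count {n} X = length (filterᵇ X (allVecs n))

  -- log_q: the least d ≤ c with q^d = c (0 if none)
  logq : ℕ → ℕ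
  logq c = foldr (λ d acc → if (q ^ d) ≡ᵇ c then d else acc) 0 (upTo (suc c))

  dim : ∀ {n} → Pred n → ℕ
  dim X = logq (count X)

  lincomb : ∀ {n} → List Carrier → List (Vecq n) → Vecq n
  lincomb cs ws = foldr _+ᵥ_ zeroV (zipWith _·ᵥ_ cs ws)

  span : ∀ {n} → List (Vecq n) → Pred n
  span ws v = any (λ c → eqVᵇ (lincomb (toList c) ws) v) (allVecs (length ws))

  record QMatroid (n : ℕ) : Set where
    field
      ρ       : Pred n → ℕ
      ρ-ext   : ∀ X Y → IsSubspace X → IsSubspace Y → X ≐ Y → ρ X ≡ ρ Y
      ρ-bound : ∀ X → IsSubspace X → ρ X ≤ dim X
      ρ-mono  : ∀ X Y → IsSubspace X → IsSubspace Y → X ⊆ Y → ρ X ≤ ρ Y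
      ρ-sub   : ∀ X Y → IsSubspace X → IsSubspace Y →
                ρ (X ⊕ Y) +ℕ ρ (X ∩ Y) ≤ ρ X +ℕ ρ Y

  module _ {n : ℕ} (M : QMatroid n) where
    open QMatroid M

    ρ* : Pred n → ℕ
    ρ* X = (dim X +ℕ ρ (perp X)) ∸ ρ full

    η* : Pred n → ℕ
    η* X = dim X ∸ ρ* X

    IsQCycleDualOfNullity : ℕ → Pred n → Set
    IsQCycleDualOfNullity i X =
      IsSubspace X × (η* X ≡ i) × (∀ W → IsSubspace W → W ⊂ X → η* W ≢ i)

    IsQCycleDual : Pred n → Set
    IsQCycleDual X = ∃ λ i → IsQCycleDualOfNullity i X

  -- projective points of F_q^n: canonical representatives = nonzero
  -- vectors whose first nonzero coordinate is 1
  normalized : ∀ {n} → Vecq n → Bool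
  normalized []      = false
  normalized (x ∷ v) = if eqᵇ x 0# then normalized v else eqᵇ x 1#

  points : (n : ℕ) → List (Vecq n)
  points n = filterᵇ normalized (allVecs n)

  ⟨_⟩ : ∀ {n} → Pred n → Pred n
  ⟨_⟩ {n} S = span (filterᵇ S (points n))

  ClRank : ∀ {n} → QMatroid n → Pred n → ℕ
  ClRank M S = QMatroid.ρ M ⟨ S ⟩

  coord : ∀ {n} (b : List (Vecq n)) → Vecq (length b) → Vecq n
  coord b c = lincomb (toList c) b

  image : ∀ {n} (b : List (Vecq n)) → Pred (length b) → Pred n
  image b V v = any (λ c → V c ∧ eqVᵇ (coord b c) v) (allVecs (length b))

  IsBasisOf : ∀ {n} → List (Vecq n) → Pred n → Set
  IsBasisOf b U =
    (∀ c → coord b c ≡ zeroV → c ≡ zeroV) ×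
    (∀ v → U v ≡ true → ∃ λ c → coord b c ≡ v) ×
    (∀ c → U (coord b c) ≡ true)

  module Posets {n : ℕ} (M : QMatroid n) (U : Pred n)
                (b : List (Vecq n)) (MU : QMatroid (length b)) where

    P1 : Poset'
    P1 = record { Carrier = Σ (Pred n) (λ V → IsQCycleDual M V × V ⊆ U)
                ; _⊑_ = λ V W → proj₁ V ⊆ proj₁ W }

    P2 : Poset'
    P2 = record { Carrier = Σ (Pred (length b)) (IsQCycleDual MU)
                ; _⊑_ = λ V W → proj₁ V ⊆ proj₁ W }

    module C3 = FinMatroid (points (length b)) (ClRank MU)
    P3 : Poset'
    P3 = record { Carrier = Σ (Pred (length b)) C3.IsCycleDual
                ; _⊑_ = λ V W → proj₁ V C3.⊆G proj₁ W }

    module C4 = FinMatroid (points n) (ClRank M)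
    R : Pred n
    R v = not (perp U v)
    P4 : Poset'
    P4 = record { Carrier = Σ (Pred n) (λ Y → C4.IsCycleDual Y × (Y C4.⊆G R))
                ; _⊑_ = λ V W → proj₁ V C4.⊆G proj₁ W }

{-# OPTIONS --safe #-}
module Submission where

-- Coordinates with respect to the basis b carry the q-cycles of M* inside U
-- bijectively onto those of M_U*, because the two dual nullities agree.
-- For any q-matroid M and subspace U, the maps V ↦ P(E) ∖ P(V^⊥) and
-- Y ↦ ⟨P(E) ∖ Y⟩^⊥ are mutually inverse, inclusion-preserving bijections
-- between the q-cycles of M* inside U and the cycles of Cl(M)* inside R(U):
-- η*(V) = ρ(E) − ρ(V^⊥) and n*(Y) = ρ(E) − ρ⟨P(E) ∖ Y⟩, so both maps preserve
-- nullity, and a cycle Y is closed in the sense that no point of Y lies in the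
-- span of the points outside Y (deleting such a point keeps the nullity).
-- Taking M_U and U = E gives (2) ≅ (3). The formula for η* needs V^⊥⊥ = V and
-- E = V^⊥ + ⟨w₁, …, w_{dim V}⟩, both proved by induction on the first coordinate.


open import Defs
open import Level using (0ℓ)
open import Algebra.Bundles using (CommutativeRing; AbelianGroup)
import Algebra.Properties.AbelianGroup
import Algebra.Properties.CommutativeSemigroup
open import Data.Nat using (ℕ; zero; suc; _≤_; _<_; z≤n; s≤s; _∸_; _≡ᵇ_)
  renaming (_+_ to _+ℕ_; _*_ to _*ℕ_; _^_ to _^ℕ_)
import Data.Nat.Properties as ℕ
open import Data.Bool using (Bool; true; false; not; _∧_; _∨_; if_then_else_; T)
open import Data.Bool.Properties using (T-≡; ¬-not; not-involutive)
open import Data.Bool.ListAction using (any; all)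
open import Data.Nat.ListAction using (sum)
open import Data.List using (List; []; _∷_; length; map; filterᵇ; foldr; _++_; cartesianProductWith; upTo)
open import Data.List.Properties using (length-++; length-map)
open import Data.List.Membership.Propositional using (_∈_; _∉_; find; lose)
open import Data.List.Membership.Propositional.Properties
  using (∈-filter⁺; ∈-filter⁻; ∈-∃++; ∈-++⁻; ∈-++⁺ˡ; ∈-++⁺ʳ; ∈-map⁺; ∈-map⁻; ∈-upTo⁺)
open import Data.List.Relation.Unary.Any using (here; there)
import Data.List.Relation.Unary.Any.Properties as Any
import Data.List.Relation.Unary.All as All
import Data.List.Relation.Unary.All.Properties as All
open import Data.List.Relation.Unary.Unique.Propositional using (Unique; []; _∷_)
import Data.List.Relation.Unary.Unique.Propositional.Properties as Unique
open import Data.Vec using ([]; _∷_; replicate)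
import Data.Vec as Vec
import Data.Vec.Properties as Vecₚ
open import Data.Product using (Σ; ∃; _×_; _,_; proj₁; proj₂)
open import Data.Sum using (_⊎_; inj₁; inj₂)
open import Data.Empty using (⊥-elim)
open import Data.Unit using (tt)
open import Function using (_∘_; Equivalence)
open import Relation.Binary.PropositionalEquality
open import Relation.Binary.Definitions using (tri<; tri≈; tri>)
open import Relation.Nullary using (yes; no)
open import Relation.Nullary.Decidable using (T?)

private variable
  A B C : Set

∧-true⁻ : ∀ {a b} → a ∧ b ≡ true → a ≡ true × b ≡ true
∧-true⁻ {true} {true} _ = refl , refl

∧-true⁺ : ∀ {a b} → a ≡ true → b ≡ true → a ∧ b ≡ true
∧-true⁺ refl refl = refl

not-true⁻ : ∀ {a} → not a ≡ true → a ≡ false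
not-true⁻ {false} _ = refl

not-true⁺ : ∀ {a} → a ≡ false → not a ≡ true
not-true⁺ refl = refl

true≢false : ∀ {a} → a ≡ true → a ≢ false
true≢false refl ()

Bool-ext : ∀ {a b} → (a ≡ true → b ≡ true) → (b ≡ true → a ≡ true) → a ≡ b
Bool-ext {true}  {true}  f g = refl
Bool-ext {true}  {false} f g = sym (f refl)
Bool-ext {false} {true}  f g = g refl
Bool-ext {false} {false} f g = refl

any-true⁻ : (p : A → Bool) (xs : List A) → any p xs ≡ true → ∃ λ x → x ∈ xs × p x ≡ true
any-true⁻ p xs e =
  let x , x∈xs , px = find (Any.any⁻ p xs (Equivalence.from T-≡ e)) in x , x∈xs , Equivalence.to T-≡ px

any-true⁺ : (p : A → Bool) {xs : List A} {x : A} → x ∈ xs → p x ≡ true → any p xs ≡ true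
any-true⁺ p x∈xs px = Equivalence.to T-≡ (Any.any⁺ p (lose x∈xs (Equivalence.from T-≡ px)))

all-true⁻ : (p : A → Bool) {xs : List A} {x : A} → all p xs ≡ true → x ∈ xs → p x ≡ true
all-true⁻ p {xs} e x∈xs = Equivalence.to T-≡ (All.lookup (All.all⁺ p xs (Equivalence.from T-≡ e)) x∈xs)

all-true⁺ : (p : A → Bool) (xs : List A) → (∀ x → x ∈ xs → p x ≡ true) → all p xs ≡ true
all-true⁺ p xs f = Equivalence.to T-≡ (All.all⁻ p (All.tabulate λ {x} x∈xs → Equivalence.from T-≡ (f x x∈xs)))

∈-filterᵇ⁻ : (p : A → Bool) (xs : List A) {x : A} → x ∈ filterᵇ p xs → x ∈ xs × p x ≡ true
∈-filterᵇ⁻ p xs m = let x∈xs , px = ∈-filter⁻ (T? ∘ p) m in x∈xs , Equivalence.to T-≡ px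

∈-filterᵇ⁺ : (p : A → Bool) {xs : List A} {x : A} → x ∈ xs → p x ≡ true → x ∈ filterᵇ p xs
∈-filterᵇ⁺ p x∈xs px = ∈-filter⁺ (T? ∘ p) x∈xs (Equivalence.from T-≡ px)

filterᵇ-cong : {p p′ : A → Bool} → (∀ x → p x ≡ p′ x) → (xs : List A) → filterᵇ p xs ≡ filterᵇ p′ xs
filterᵇ-cong h [] = refl
filterᵇ-cong {p′ = p′} h (x ∷ xs) rewrite h x with p′ x
... | true  = cong (x ∷_) (filterᵇ-cong h xs)
... | false = filterᵇ-cong h xs

length-filterᵇ-++ : (p : A → Bool) (xs ys : List A) →
                    length (filterᵇ p (xs ++ ys)) ≡ length (filterᵇ p xs) +ℕ length (filterᵇ p ys)
length-filterᵇ-++ p [] ys = refl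
length-filterᵇ-++ p (x ∷ xs) ys with p x
... | true  = cong suc (length-filterᵇ-++ p xs ys)
... | false = length-filterᵇ-++ p xs ys

length-filterᵇ-map : (p : B → Bool) (f : A → B) (xs : List A) →
                     length (filterᵇ p (map f xs)) ≡ length (filterᵇ (p ∘ f) xs)
length-filterᵇ-map p f [] = refl
length-filterᵇ-map p f (x ∷ xs) with p (f x)
... | true  = cong suc (length-filterᵇ-map p f xs)
... | false = length-filterᵇ-map p f xs

length-filterᵇ-none : (p : A → Bool) → (∀ x → p x ≡ false) → (xs : List A) → length (filterᵇ p xs) ≡ 0
length-filterᵇ-none p h [] = refl
length-filterᵇ-none p h (x ∷ xs) rewrite h x = length-filterᵇ-none p h xs

length-cartesianProductWith : (f : A → B → C) (xs : List A) (ys : List B) →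
                              length (cartesianProductWith f xs ys) ≡ length xs *ℕ length ys
length-cartesianProductWith f [] ys = refl
length-cartesianProductWith f (x ∷ xs) ys =
  trans (length-++ (map (f x) ys)) (cong₂ _+ℕ_ (length-map (f x) ys) (length-cartesianProductWith f xs ys))

sum-map-const : (f : A → ℕ) {c : ℕ} → (∀ x → f x ≡ c) → ∀ xs → sum (map f xs) ≡ length xs *ℕ c
sum-map-const f f≡c []       = refl
sum-map-const f f≡c (x ∷ xs) = cong₂ _+ℕ_ (f≡c x) (sum-map-const f f≡c xs)

Unique-⊆⇒length≤ : (xs ys : List A) → Unique xs → (∀ x → x ∈ xs → x ∈ ys) → length xs ≤ length ys
Unique-⊆⇒length≤ [] ys _ _ = z≤n
Unique-⊆⇒length≤ (x ∷ xs) ys (x∉xs ∷ uxs) xs⊆ys with ∈-∃++ (xs⊆ys x (here refl))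
... | l , r , refl = begin
    suc (length xs)         ≤⟨ s≤s (Unique-⊆⇒length≤ xs (l ++ r) uxs xs⊆l++r) ⟩
    suc (length (l ++ r))   ≡⟨ cong suc (length-++ l) ⟩
    suc (length l +ℕ length r) ≡⟨ ℕ.+-suc (length l) (length r) ⟨
    length l +ℕ length (x ∷ r) ≡⟨ length-++ l ⟨
    length (l ++ x ∷ r)     ∎
  where
  open ℕ.≤-Reasoning
  xs⊆l++r : ∀ z → z ∈ xs → z ∈ l ++ r
  xs⊆l++r z z∈xs with ∈-++⁻ l (xs⊆ys z (there z∈xs))
  ... | inj₁ z∈l         = ∈-++⁺ˡ z∈l
  ... | inj₂ (here refl) = ⊥-elim (All.lookup x∉xs z∈xs refl)
  ... | inj₂ (there z∈r) = ∈-++⁺ʳ l z∈r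

m∸[[m+n]∸o]≡o∸n : ∀ m n o → n ≤ o → o ≤ m +ℕ n → m ∸ ((m +ℕ n) ∸ o) ≡ o ∸ n
m∸[[m+n]∸o]≡o∸n m n o n≤o o≤m+n = begin
    m ∸ ((m +ℕ n) ∸ o)        ≡⟨ cong (λ z → m ∸ ((m +ℕ n) ∸ z)) (ℕ.m+[n∸m]≡n n≤o) ⟨
    m ∸ ((m +ℕ n) ∸ (n +ℕ k)) ≡⟨ cong (λ z → m ∸ (z ∸ (n +ℕ k))) (ℕ.+-comm m n) ⟩
    m ∸ ((n +ℕ m) ∸ (n +ℕ k)) ≡⟨ cong (m ∸_) (ℕ.[m+n]∸[m+o]≡n∸o n m k) ⟩
    m ∸ (m ∸ k)               ≡⟨ ℕ.m∸[m∸n]≡n (ℕ.m≤n+o⇒m∸n≤o o n (subst (o ≤_) (ℕ.+-comm m n) o≤m+n)) ⟩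
    k                         ∎
  where
  open ≡-Reasoning
  k : ℕ
  k = o ∸ n

⊆G-trans : {G : List A} {r : (A → Bool) → ℕ} {X Y Z : A → Bool} → let open FinMatroid G r in
           X ⊆G Y → Y ⊆G Z → X ⊆G Z
⊆G-trans X⊆Y Y⊆Z a a∈ Xa = Y⊆Z a a∈ (X⊆Y a a∈ Xa)

Transitive⊑ : Poset' → Set
Transitive⊑ P = ∀ {x y z} → x ⊑ y → y ⊑ z → x ⊑ z
  where open Poset' P

OrderIso-trans : {P Q R : Poset'} → Transitive⊑ P → Transitive⊑ Q → Transitive⊑ R →
                 OrderIso P Q → OrderIso Q R → OrderIso P R
OrderIso-trans {P} {Q} {R} P-trans Q-trans R-trans f g = record
  { to      = g.to ∘ f.to
  ; from    = f.from ∘ g.from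
  ; to-mono = λ x y → g.to-mono _ _ ∘ f.to-mono x y
  ; to-refl = λ x y → f.to-refl x y ∘ g.to-refl _ _
  ; from-to = λ x → P-trans (from-mono _ _ (proj₁ (g.from-to (f.to x)))) (proj₁ (f.from-to x))
                  , P-trans (proj₂ (f.from-to x)) (from-mono _ _ (proj₂ (g.from-to (f.to x))))
  ; to-from = λ z → R-trans (g.to-mono _ _ (proj₁ (f.to-from (g.from z)))) (proj₁ (g.to-from z))
                  , R-trans (proj₂ (g.to-from z)) (g.to-mono _ _ (proj₂ (f.to-from (g.from z))))
  }
  where
  module f = OrderIso f
  module g = OrderIso g
  from-mono : ∀ y y′ → Poset'._⊑_ Q y y′ → Poset'._⊑_ P (f.from y) (f.from y′)
  from-mono y y′ y⊑y′ = f.to-refl _ _ (Q-trans (proj₁ (f.to-from y)) (Q-trans y⊑y′ (proj₂ (f.to-from y′))))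

module LinearAlgebra (F : FiniteField) where
  open FiniteField F using (isCommutativeRing; 0≢1; inverse; _≟_; elements; complete; unique; q)
  open Over F public

  ring : CommutativeRing 0ℓ 0ℓ
  ring = record { isCommutativeRing = isCommutativeRing }

  open CommutativeRing ring using (Carrier; _+_; _*_; -_; 0#; 1#; +-assoc; +-comm; *-assoc; *-comm;
    +-identityˡ; +-identityʳ; *-identityˡ; *-identityʳ; distribˡ; distribʳ; -‿inverseˡ; -‿inverseʳ;
    zeroˡ; zeroʳ; +-abelianGroup)
  open import Algebra.Properties.Ring (CommutativeRing.ring ring) using (-‿distribˡ-*; -‿distribʳ-*; -1*x≈-x)
  open Algebra.Properties.AbelianGroup +-abelianGroup using () renaming (//-rightDividesʳ to +-//-rightDividesʳ)
  open Algebra.Properties.CommutativeSemigroup (AbelianGroup.commutativeSemigroup +-abelianGroup)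
    using () renaming (interchange to +-interchange)

  -a*x≡-x*a : ∀ a x → (- a) * x ≡ (- x) * a
  -a*x≡-x*a a x = trans (sym (-‿distribˡ-* a x)) (trans (cong -_ (*-comm a x)) (-‿distribˡ-* x a))

  +ᵥ-abelianGroup : ℕ → AbelianGroup 0ℓ 0ℓ
  +ᵥ-abelianGroup n = record
    { Carrier = Vecq n ; _≈_ = _≡_ ; _∙_ = _+ᵥ_ ; ε = zeroV ; _⁻¹ = Vec.map -_
    ; isAbelianGroup = record
      { isGroup = record
        { isMonoid = record
          { isSemigroup = record
            { isMagma = record { isEquivalence = isEquivalence ; ∙-cong = cong₂ _+ᵥ_ }
            ; assoc = Vecₚ.zipWith-assoc +-assoc }
          ; identity = Vecₚ.zipWith-identityˡ +-identityˡ , Vecₚ.zipWith-identityʳ +-identityʳ }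
        ; inverse = Vecₚ.zipWith-inverseˡ -‿inverseˡ , Vecₚ.zipWith-inverseʳ -‿inverseʳ
        ; ⁻¹-cong = cong (Vec.map -_) }
      ; comm = Vecₚ.zipWith-comm +-comm } }

  module Vector {n : ℕ} where
    open AbelianGroup (+ᵥ-abelianGroup n) public
      using () renaming (assoc to +ᵥ-assoc; comm to +ᵥ-comm; identityˡ to +ᵥ-identityˡ;
                        identityʳ to +ᵥ-identityʳ; inverseʳ to -ᵥ-self)
    open Algebra.Properties.AbelianGroup (+ᵥ-abelianGroup n) public
      using (∙-cancelʳ; x∙y⁻¹≈ε⇒x≈y; \\-leftDividesˡ; //-rightDividesˡ; //-rightDividesʳ; ⁻¹-∙-comm)
    open Algebra.Properties.CommutativeSemigroup (AbelianGroup.commutativeSemigroup (+ᵥ-abelianGroup n)) public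
      using (interchange)

  open Vector public

  private variable
    n : ℕ

  +ᵥ-[-ᵥ] : (u v : Vecq n) → u +ᵥ (v -ᵥ u) ≡ v
  +ᵥ-[-ᵥ] u v = trans (cong (u +ᵥ_) (+ᵥ-comm v _)) (\\-leftDividesˡ u v)

  [+ᵥ]-ᵥˡ : (u v : Vecq n) → (u +ᵥ v) -ᵥ u ≡ v
  [+ᵥ]-ᵥˡ u v = trans (cong (_-ᵥ u) (+ᵥ-comm u v)) (//-rightDividesʳ u v)

  [-ᵥ]+ᵥ : (u v : Vecq n) → (u -ᵥ v) +ᵥ v ≡ u
  [-ᵥ]+ᵥ u v = //-rightDividesˡ v u

  -ᵥ-interchange : (u v x y : Vecq n) → (u +ᵥ v) -ᵥ (x +ᵥ y) ≡ (u -ᵥ x) +ᵥ (v -ᵥ y)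
  -ᵥ-interchange u v x y = trans (cong ((u +ᵥ v) +ᵥ_) (sym (⁻¹-∙-comm x y))) (interchange u v _ _)

  ·ᵥ-distribˡ : ∀ a (u v : Vecq n) → a ·ᵥ (u +ᵥ v) ≡ (a ·ᵥ u) +ᵥ (a ·ᵥ v)
  ·ᵥ-distribˡ a [] [] = refl
  ·ᵥ-distribˡ a (x ∷ u) (y ∷ v) = cong₂ _∷_ (distribˡ a x y) (·ᵥ-distribˡ a u v)

  ·ᵥ-distribʳ : ∀ a b (u : Vecq n) → (a + b) ·ᵥ u ≡ (a ·ᵥ u) +ᵥ (b ·ᵥ u)
  ·ᵥ-distribʳ a b [] = refl
  ·ᵥ-distribʳ a b (x ∷ u) = cong₂ _∷_ (distribʳ x a b) (·ᵥ-distribʳ a b u)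

  ·ᵥ-assoc : ∀ a b (u : Vecq n) → a ·ᵥ (b ·ᵥ u) ≡ (a * b) ·ᵥ u
  ·ᵥ-assoc a b [] = refl
  ·ᵥ-assoc a b (x ∷ u) = cong₂ _∷_ (sym (*-assoc a b x)) (·ᵥ-assoc a b u)

  ·ᵥ-identityˡ : (u : Vecq n) → 1# ·ᵥ u ≡ u
  ·ᵥ-identityˡ [] = refl
  ·ᵥ-identityˡ (x ∷ u) = cong₂ _∷_ (*-identityˡ x) (·ᵥ-identityˡ u)

  ·ᵥ-zeroˡ : (u : Vecq n) → 0# ·ᵥ u ≡ zeroV
  ·ᵥ-zeroˡ [] = refl
  ·ᵥ-zeroˡ (x ∷ u) = cong₂ _∷_ (zeroˡ x) (·ᵥ-zeroˡ u)

  ·ᵥ-zeroʳ : ∀ {n} a → a ·ᵥ zeroV {n} ≡ zeroV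
  ·ᵥ-zeroʳ {n} a = trans (Vecₚ.map-replicate (a *_) 0# n) (cong (replicate n) (zeroʳ a))

  -1·ᵥ : (u : Vecq n) → (- 1#) ·ᵥ u ≡ Vec.map -_ u
  -1·ᵥ u = Vecₚ.map-cong -1*x≈-x u

  ·ᵥ-distrib-ᵥ : ∀ a (u v : Vecq n) → (a ·ᵥ u) -ᵥ (a ·ᵥ v) ≡ a ·ᵥ (u -ᵥ v)
  ·ᵥ-distrib-ᵥ a [] [] = refl
  ·ᵥ-distrib-ᵥ a (x ∷ u) (y ∷ v) =
    cong₂ _∷_ (trans (cong ((a * x) +_) (-‿distribʳ-* a y)) (sym (distribˡ a x (- y)))) (·ᵥ-distrib-ᵥ a u v)

  dot-comm : (u v : Vecq n) → dot u v ≡ dot v u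
  dot-comm [] [] = refl
  dot-comm (x ∷ u) (y ∷ v) = cong₂ _+_ (*-comm x y) (dot-comm u v)

  dot-zeroˡ : (w : Vecq n) → dot zeroV w ≡ 0#
  dot-zeroˡ [] = refl
  dot-zeroˡ (z ∷ w) = trans (cong₂ _+_ (zeroˡ z) (dot-zeroˡ w)) (+-identityˡ 0#)

  dot-+ˡ : (u v w : Vecq n) → dot (u +ᵥ v) w ≡ dot u w + dot v w
  dot-+ˡ [] [] [] = sym (+-identityˡ 0#)
  dot-+ˡ (x ∷ u) (y ∷ v) (z ∷ w) = trans (cong₂ _+_ (distribʳ z x y) (dot-+ˡ u v w)) (+-interchange _ _ _ _)

  dot-·ˡ : ∀ a (u w : Vecq n) → dot (a ·ᵥ u) w ≡ a * dot u w
  dot-·ˡ a [] [] = sym (zeroʳ a)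
  dot-·ˡ a (x ∷ u) (z ∷ w) = trans (cong₂ _+_ (*-assoc a x z) (dot-·ˡ a u w)) (sym (distribˡ a _ _))

  dot-zeroʳ : (w : Vecq n) → dot w zeroV ≡ 0#
  dot-zeroʳ w = trans (dot-comm w zeroV) (dot-zeroˡ w)

  dot-+ʳ : (w u v : Vecq n) → dot w (u +ᵥ v) ≡ dot w u + dot w v
  dot-+ʳ w u v = trans (dot-comm w _) (trans (dot-+ˡ u v w) (cong₂ _+_ (dot-comm u w) (dot-comm v w)))

  dot-·ʳ : ∀ a (w u : Vecq n) → dot w (a ·ᵥ u) ≡ a * dot w u
  dot-·ʳ a w u = trans (dot-comm w _) (trans (dot-·ˡ a u w) (cong (a *_) (dot-comm u w)))

  allVecs-complete : (v : Vecq n) → v ∈ allVecs n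
  allVecs-complete [] = here refl
  allVecs-complete (x ∷ v) = Any.cartesianProductWith⁺ _∷_ (cong₂ _∷_) (complete x) (allVecs-complete v)

  allVecs-unique : ∀ n → Unique (allVecs n)
  allVecs-unique zero = All.[] ∷ []
  allVecs-unique (suc n) = Unique.cartesianProductWith⁺ _∷_ (λ { refl → refl , refl }) unique (allVecs-unique n)

  length-allVecs : ∀ n → length (allVecs n) ≡ q ^ℕ n
  length-allVecs zero = refl
  length-allVecs (suc n) =
    trans (length-cartesianProductWith _∷_ elements (allVecs n)) (cong (q *ℕ_) (length-allVecs n))

  eqᵇ⁻ : ∀ {a b} → eqᵇ a b ≡ true → a ≡ b
  eqᵇ⁻ {a} {b} e with a ≟ b
  ... | yes a≡b = a≡b

  eqᵇ⁺ : ∀ {a b} → a ≡ b → eqᵇ a b ≡ true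
  eqᵇ⁺ {a} {b} a≡b with a ≟ b
  ... | yes _  = refl
  ... | no a≢b = ⊥-elim (a≢b a≡b)

  eqᵇ-false : ∀ {a b} → a ≢ b → eqᵇ a b ≡ false
  eqᵇ-false {a} {b} a≢b = ¬-not (a≢b ∘ eqᵇ⁻)

  eqVᵇ⁻ : {u v : Vecq n} → eqVᵇ u v ≡ true → u ≡ v
  eqVᵇ⁻ {u = u} {v} e with Vecₚ.≡-dec _≟_ u v
  ... | yes u≡v = u≡v

  eqVᵇ⁺ : {u v : Vecq n} → u ≡ v → eqVᵇ u v ≡ true
  eqVᵇ⁺ {u = u} {v} u≡v with Vecₚ.≡-dec _≟_ u v
  ... | yes _  = refl
  ... | no u≢v = ⊥-elim (u≢v u≡v)

  ∈-resp-≡ : (X : Pred n) {u v : Vecq n} → u ≡ v → X u ≡ true → X v ≡ true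
  ∈-resp-≡ X = subst (λ z → X z ≡ true)

  ∈perp⁻ : (X : Pred n) (v : Vecq n) → perp X v ≡ true → ∀ w → X w ≡ true → dot v w ≡ 0#
  ∈perp⁻ X v e w Xw = eqᵇ⁻ (subst (λ b → not b ∨ eqᵇ (dot v w) 0# ≡ true) Xw
    (all-true⁻ (λ w → not (X w) ∨ eqᵇ (dot v w) 0#) e (allVecs-complete w)))

  ∈perp⁺ : (X : Pred n) (v : Vecq n) → (∀ w → X w ≡ true → dot v w ≡ 0#) → perp X v ≡ true
  ∈perp⁺ {n} X v v⊥X = all-true⁺ _ (allVecs n) λ w _ → orthogonal w
    where
    orthogonal : ∀ w → not (X w) ∨ eqᵇ (dot v w) 0# ≡ true
    orthogonal w with X w in Xw
    ... | true  = eqᵇ⁺ (v⊥X w Xw)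
    ... | false = refl

  ∈⊕⁻ : (X Y : Pred n) {v : Vecq n} → (X ⊕ Y) v ≡ true → ∃ λ x → X x ≡ true × Y (v -ᵥ x) ≡ true
  ∈⊕⁻ {n} X Y e = let x , _ , x,v-x = any-true⁻ _ (allVecs n) e in x , ∧-true⁻ x,v-x

  ∈⊕⁺ : (X Y : Pred n) {x y : Vecq n} → X x ≡ true → Y y ≡ true → (X ⊕ Y) (x +ᵥ y) ≡ true
  ∈⊕⁺ X Y {x} {y} Xx Yy =
    any-true⁺ _ (allVecs-complete x) (∧-true⁺ Xx (∈-resp-≡ Y (sym ([+ᵥ]-ᵥˡ x y)) Yy))

  ∈image⁻ : (b : List (Vecq n)) (V : Pred (length b)) {v : Vecq n} →
            image b V v ≡ true → ∃ λ c → V c ≡ true × coord b c ≡ v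
  ∈image⁻ b V e =
    let c , _ , Vc,bc≡v = any-true⁻ _ (allVecs (length b)) e
        Vc , bc≡v = ∧-true⁻ Vc,bc≡v
    in c , Vc , eqVᵇ⁻ bc≡v

  ∈image⁺ : (b : List (Vecq n)) (V : Pred (length b)) {c : Vecq (length b)} →
            V c ≡ true → image b V (coord b c) ≡ true
  ∈image⁺ b V {c} Vc = any-true⁺ _ (allVecs-complete c) (∧-true⁺ Vc (eqVᵇ⁺ refl))

  ∈span⁻ : (ws : List (Vecq n)) {v : Vecq n} → span ws v ≡ true → ∃ λ c → coord ws c ≡ v
  ∈span⁻ ws e = let c , _ , wc≡v = any-true⁻ _ (allVecs (length ws)) e in c , eqVᵇ⁻ wc≡v

  ∈span⁺ : (ws : List (Vecq n)) (c : Vecq (length ws)) → span ws (coord ws c) ≡ true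
  ∈span⁺ ws c = any-true⁺ _ (allVecs-complete c) (eqVᵇ⁺ refl)

  coord-+ : (ws : List (Vecq n)) (c d : Vecq (length ws)) → coord ws (c +ᵥ d) ≡ coord ws c +ᵥ coord ws d
  coord-+ [] [] [] = sym (+ᵥ-identityˡ zeroV)
  coord-+ (w ∷ ws) (x ∷ c) (y ∷ d) =
    trans (cong₂ _+ᵥ_ (·ᵥ-distribʳ x y w) (coord-+ ws c d)) (interchange _ _ _ _)

  coord-· : (ws : List (Vecq n)) (a : Carrier) (c : Vecq (length ws)) → coord ws (a ·ᵥ c) ≡ a ·ᵥ coord ws c
  coord-· [] a [] = sym (·ᵥ-zeroʳ a)
  coord-· (w ∷ ws) a (x ∷ c) =
    trans (cong₂ _+ᵥ_ (sym (·ᵥ-assoc a x w)) (coord-· ws a c)) (sym (·ᵥ-distribˡ a _ _))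

  coord-zero : (ws : List (Vecq n)) → coord ws zeroV ≡ zeroV
  coord-zero [] = refl
  coord-zero (w ∷ ws) = trans (cong₂ _+ᵥ_ (·ᵥ-zeroˡ w) (coord-zero ws)) (+ᵥ-identityˡ zeroV)

  coord-ᵥ : (ws : List (Vecq n)) (c d : Vecq (length ws)) → coord ws (c -ᵥ d) ≡ coord ws c -ᵥ coord ws d
  coord-ᵥ ws c d = begin
    coord ws (c +ᵥ Vec.map -_ d)             ≡⟨ cong (coord ws ∘ (c +ᵥ_)) (-1·ᵥ d) ⟨
    coord ws (c +ᵥ ((- 1#) ·ᵥ d))            ≡⟨ coord-+ ws c _ ⟩
    coord ws c +ᵥ coord ws ((- 1#) ·ᵥ d)     ≡⟨ cong (coord ws c +ᵥ_) (coord-· ws (- 1#) d) ⟩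
    coord ws c +ᵥ ((- 1#) ·ᵥ coord ws d)     ≡⟨ cong (coord ws c +ᵥ_) (-1·ᵥ _) ⟩
    coord ws c -ᵥ coord ws d                 ∎
    where open ≡-Reasoning

  coord-member : (ws : List (Vecq n)) {w : Vecq n} → w ∈ ws → ∃ λ c → coord ws c ≡ w
  coord-member (w ∷ ws) (here refl) =
    (1# ∷ zeroV) , trans (cong₂ _+ᵥ_ (·ᵥ-identityˡ w) (coord-zero ws)) (+ᵥ-identityʳ w)
  coord-member (w′ ∷ ws) (there w∈ws) =
    let c , wsc≡w = coord-member ws w∈ws in (0# ∷ c) , trans (cong₂ _+ᵥ_ (·ᵥ-zeroˡ w′) wsc≡w) (+ᵥ-identityˡ _)

  ∈span-member : (ws : List (Vecq n)) {w : Vecq n} → w ∈ ws → span ws w ≡ true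
  ∈span-member ws w∈ws = let c , wsc≡w = coord-member ws w∈ws in ∈-resp-≡ (span ws) wsc≡w (∈span⁺ ws c)

  coefficients : List Carrier → (ws : List (Vecq n)) → Vecq (length ws)
  coefficients cs       []       = []
  coefficients []       (w ∷ ws) = 0# ∷ coefficients [] ws
  coefficients (c ∷ cs) (w ∷ ws) = c ∷ coefficients cs ws

  coord-coefficients : ∀ cs (ws : List (Vecq n)) → coord ws (coefficients cs ws) ≡ lincomb cs ws
  coord-coefficients []       []       = refl
  coord-coefficients (c ∷ cs) []       = refl
  coord-coefficients []       (w ∷ ws) = trans (cong₂ _+ᵥ_ (·ᵥ-zeroˡ w) (coord-coefficients [] ws)) (+ᵥ-identityˡ zeroV)
  coord-coefficients (c ∷ cs) (w ∷ ws) = cong ((c ·ᵥ w) +ᵥ_) (coord-coefficients cs ws)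

  ∈span-lincomb : (ws : List (Vecq n)) (cs : List Carrier) → span ws (lincomb cs ws) ≡ true
  ∈span-lincomb ws cs = ∈-resp-≡ (span ws) (coord-coefficients cs ws) (∈span⁺ ws (coefficients cs ws))

  ∁ : Pred n → Pred n
  ∁ X v = not (X v)

  0∈ : {X : Pred n} → IsSubspace X → X zeroV ≡ true
  0∈ (X0 , _ , _) = X0

  +∈ : {X : Pred n} → IsSubspace X → {u v : Vecq n} → X u ≡ true → X v ≡ true → X (u +ᵥ v) ≡ true
  +∈ (_ , X+ , _) = X+ _ _

  ·∈ : {X : Pred n} → IsSubspace X → ∀ a {v : Vecq n} → X v ≡ true → X (a ·ᵥ v) ≡ true
  ·∈ (_ , _ , X·) a = X· a _

  ⊆-trans : {X Y Z : Pred n} → X ⊆ Y → Y ⊆ Z → X ⊆ Z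
  ⊆-trans X⊆Y Y⊆Z v Xv = Y⊆Z v (X⊆Y v Xv)

  full-isSubspace : IsSubspace (full {n})
  full-isSubspace = refl , (λ _ _ _ _ → refl) , (λ _ _ _ → refl)

  perp-isSubspace : (X : Pred n) → IsSubspace (perp X)
  perp-isSubspace X =
      ∈perp⁺ X zeroV (λ w _ → dot-zeroˡ w)
    , (λ u v u⊥X v⊥X → ∈perp⁺ X (u +ᵥ v) λ w Xw →
         trans (dot-+ˡ u v w) (trans (cong₂ _+_ (∈perp⁻ X u u⊥X w Xw) (∈perp⁻ X v v⊥X w Xw)) (+-identityˡ 0#)))
    , (λ a v v⊥X → ∈perp⁺ X (a ·ᵥ v) λ w Xw →
         trans (dot-·ˡ a v w) (trans (cong (a *_) (∈perp⁻ X v v⊥X w Xw)) (zeroʳ a)))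

  perp-antitone : {X Y : Pred n} → X ⊆ Y → perp Y ⊆ perp X
  perp-antitone {X = X} {Y} X⊆Y v v⊥Y = ∈perp⁺ X v λ w Xw → ∈perp⁻ Y v v⊥Y w (X⊆Y w Xw)

  ⊆-perp-perp : (X : Pred n) → X ⊆ perp (perp X)
  ⊆-perp-perp X v Xv = ∈perp⁺ (perp X) v λ w w⊥X → trans (dot-comm v w) (∈perp⁻ X w w⊥X v Xv)

  ⊕-isSubspace : {X Y : Pred n} → IsSubspace X → IsSubspace Y → IsSubspace (X ⊕ Y)
  ⊕-isSubspace {X = X} {Y} X-sub Y-sub =
      ∈-resp-≡ (X ⊕ Y) (+ᵥ-identityˡ zeroV) (∈⊕⁺ X Y (0∈ X-sub) (0∈ Y-sub))
    , (λ u v u∈ v∈ →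
         let x , Xx , Yu-x = ∈⊕⁻ X Y u∈ ; y , Xy , Yv-y = ∈⊕⁻ X Y v∈
         in ∈-resp-≡ (X ⊕ Y) (+ᵥ-[-ᵥ] (x +ᵥ y) (u +ᵥ v))
              (∈⊕⁺ X Y (+∈ X-sub Xx Xy) (∈-resp-≡ Y (sym (-ᵥ-interchange u v x y)) (+∈ Y-sub Yu-x Yv-y))))
    , (λ a v v∈ →
         let x , Xx , Yv-x = ∈⊕⁻ X Y v∈
         in ∈-resp-≡ (X ⊕ Y) (+ᵥ-[-ᵥ] (a ·ᵥ x) (a ·ᵥ v))
              (∈⊕⁺ X Y (·∈ X-sub a Xx) (∈-resp-≡ Y (sym (·ᵥ-distrib-ᵥ a v x)) (·∈ Y-sub a Yv-x))))

  span-isSubspace : (ws : List (Vecq n)) → IsSubspace (span ws)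
  span-isSubspace ws =
      ∈-resp-≡ (span ws) (coord-zero ws) (∈span⁺ ws zeroV)
    , (λ u v u∈ v∈ → let c , wsc≡u = ∈span⁻ ws u∈ ; d , wsd≡v = ∈span⁻ ws v∈ in
         ∈-resp-≡ (span ws) (trans (coord-+ ws c d) (cong₂ _+ᵥ_ wsc≡u wsd≡v)) (∈span⁺ ws (c +ᵥ d)))
    , (λ a v v∈ → let c , wsc≡v = ∈span⁻ ws v∈ in
         ∈-resp-≡ (span ws) (trans (coord-· ws a c) (cong (a ·ᵥ_) wsc≡v)) (∈span⁺ ws (a ·ᵥ c)))

  span-least : {X : Pred n} → IsSubspace X → (ws : List (Vecq n)) → (∀ w → w ∈ ws → X w ≡ true) → span ws ⊆ X
  span-least {X = X} X-sub ws ws⊆X v v∈ = let c , wsc≡v = ∈span⁻ ws v∈ in ∈-resp-≡ X wsc≡v (coord∈ ws ws⊆X c)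
    where
    coord∈ : ∀ ws → (∀ w → w ∈ ws → X w ≡ true) → ∀ c → X (coord ws c) ≡ true
    coord∈ []       _     []      = 0∈ X-sub
    coord∈ (w ∷ ws) ws⊆X (x ∷ c) =
      +∈ X-sub (·∈ X-sub x (ws⊆X w (here refl))) (coord∈ ws (λ w′ → ws⊆X w′ ∘ there) c)

  count-cong : {P P′ : Pred n} → (∀ v → P v ≡ P′ v) → count P ≡ count P′
  count-cong {n} P≗P′ = cong length (filterᵇ-cong P≗P′ (allVecs n))

  count-∷ : (P : Pred (suc n)) → count P ≡ sum (map (λ x → count (λ v → P (x ∷ v))) elements)
  count-∷ {n} P = go elements
    where
    go : ∀ xs → length (filterᵇ P (cartesianProductWith _∷_ xs (allVecs n)))
                ≡ sum (map (λ x → count (λ v → P (x ∷ v))) xs)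
    go []       = refl
    go (x ∷ xs) = trans (length-filterᵇ-++ P (map (x ∷_) (allVecs n)) _)
                        (cong₂ _+ℕ_ (length-filterᵇ-map P (x ∷_) (allVecs n)) (go xs))

  sum-map-supported-at-0 : (f : Carrier → ℕ) → (∀ x → x ≢ 0# → f x ≡ 0) → sum (map f elements) ≡ f 0#
  sum-map-supported-at-0 f f≡0 = go elements unique (complete 0#)
    where
    sum-zero : ∀ xs → 0# ∉ xs → sum (map f xs) ≡ 0
    sum-zero []       _     = refl
    sum-zero (x ∷ xs) 0∉x∷xs =
      cong₂ _+ℕ_ (f≡0 x (λ x≡0 → 0∉x∷xs (here (sym x≡0)))) (sum-zero xs (0∉x∷xs ∘ there))
    go : ∀ xs → Unique xs → 0# ∈ xs → sum (map f xs) ≡ f 0#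
    go (x ∷ xs) (x∉xs ∷ _)   (here refl) =
      trans (cong (f x +ℕ_) (sum-zero xs (λ x∈xs → All.lookup x∉xs x∈xs refl))) (ℕ.+-identityʳ (f x))
    go (x ∷ xs) (x∉xs ∷ uxs) (there 0∈xs) with x ≟ 0#
    ... | yes refl = ⊥-elim (All.lookup x∉xs 0∈xs refl)
    ... | no x≢0   = trans (cong (_+ℕ sum (map f xs)) (f≡0 x x≢0)) (go xs uxs 0∈xs)

  count-none : (P : Pred n) → (∀ v → P v ≡ false) → count P ≡ 0
  count-none {n} P P≡false = length-filterᵇ-none P P≡false (allVecs n)

  count-translate-≤ : (P : Pred n) (t : Vecq n) → count (λ v → P (v +ᵥ t)) ≤ count P
  count-translate-≤ {n} P t = subst (_≤ count P) (length-map (_+ᵥ t) Pt)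
    (Unique-⊆⇒length≤ (map (_+ᵥ t) Pt) (filterᵇ P (allVecs n))
      (Unique.map⁺ (∙-cancelʳ t _ _) (Unique.filter⁺ _ (allVecs-unique n))) translate∈)
    where
    Pt : List (Vecq n)
    Pt = filterᵇ (λ v → P (v +ᵥ t)) (allVecs n)
    translate∈ : ∀ x → x ∈ map (_+ᵥ t) Pt → x ∈ filterᵇ P (allVecs n)
    translate∈ x x∈ = let y , y∈Pt , x≡y+t = ∈-map⁻ (_+ᵥ t) x∈ in
      ∈-filterᵇ⁺ P (allVecs-complete x) (∈-resp-≡ P (sym x≡y+t) (proj₂ (∈-filterᵇ⁻ _ (allVecs n) y∈Pt)))

  count-translate : (P : Pred n) (t : Vecq n) → count (λ v → P (v +ᵥ t)) ≡ count P
  count-translate P t = ℕ.≤-antisym (count-translate-≤ P t)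
    (subst (_≤ count (λ v → P (v +ᵥ t))) (count-cong λ v → cong P ([-ᵥ]+ᵥ v t))
      (count-translate-≤ (λ v → P (v +ᵥ t)) (Vec.map -_ t)))

  count-span-≤ : (ws : List (Vecq n)) → count (span ws) ≤ q ^ℕ length ws
  count-span-≤ {n} ws =
    subst (count (span ws) ≤_) (trans (length-map (coord ws) (allVecs (length ws))) (length-allVecs (length ws)))
      (Unique-⊆⇒length≤ _ _ (Unique.filter⁺ _ (allVecs-unique n)) λ v v∈ →
        let c , wsc≡v = ∈span⁻ ws (proj₂ (∈-filterᵇ⁻ (span ws) (allVecs n) v∈)) in
        subst (_∈ map (coord ws) (allVecs (length ws))) wsc≡v (∈-map⁺ (coord ws) (allVecs-complete c)))

  q≥2 : 2 ≤ q
  q≥2 = Unique-⊆⇒length≤ (0# ∷ 1# ∷ []) elements ((0≢1 All.∷ All.[]) ∷ All.[] ∷ []) (λ x _ → complete x)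

  q^-injective : ∀ a b → q ^ℕ a ≡ q ^ℕ b → a ≡ b
  q^-injective a b q^a≡q^b with ℕ.<-cmp a b
  ... | tri< a<b _ _ = ⊥-elim (ℕ.<-irrefl q^a≡q^b (ℕ.^-monoʳ-< q q≥2 a<b))
  ... | tri≈ _ a≡b _ = a≡b
  ... | tri> _ _ b<a = ⊥-elim (ℕ.<-irrefl (sym q^a≡q^b) (ℕ.^-monoʳ-< q q≥2 b<a))

  n<q^n : ∀ n → n < q ^ℕ n
  n<q^n zero    = s≤s z≤n
  n<q^n (suc n) = ℕ.≤-<-trans (n<q^n n) (ℕ.^-monoʳ-< q q≥2 (ℕ.n<1+n n))

  private
    logSearch : ℕ → List ℕ → ℕ
    logSearch c = foldr (λ d acc → if (q ^ℕ d) ≡ᵇ c then d else acc) 0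

    logSearch-spec : ∀ c ds → logSearch c ds ≡ 0 ⊎ q ^ℕ logSearch c ds ≡ c
    logSearch-spec c []       = inj₁ refl
    logSearch-spec c (d ∷ ds) with (q ^ℕ d) ≡ᵇ c in q^d≡ᵇc
    ... | true  = inj₂ (ℕ.≡ᵇ⇒≡ _ _ (subst T (sym q^d≡ᵇc) tt))
    ... | false = logSearch-spec c ds

    logSearch-q^ : ∀ d ds → d ∈ ds → logSearch (q ^ℕ d) ds ≡ d
    logSearch-q^ d (d′ ∷ ds) d∈ with (q ^ℕ d′) ≡ᵇ (q ^ℕ d) in q^d′≡ᵇq^d
    ... | true = q^-injective d′ d (ℕ.≡ᵇ⇒≡ _ _ (subst T (sym q^d′≡ᵇq^d) tt))
    logSearch-q^ d (d′ ∷ ds) (here refl)  | false = ⊥-elim (subst T q^d′≡ᵇq^d (ℕ.≡⇒≡ᵇ (q ^ℕ d) _ refl))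
    logSearch-q^ d (d′ ∷ ds) (there d∈ds) | false = logSearch-q^ d ds d∈ds

  logq-q^ : ∀ d → logq (q ^ℕ d) ≡ d
  logq-q^ d = logSearch-q^ d (upTo (suc (q ^ℕ d))) (∈-upTo⁺ (s≤s (ℕ.<⇒≤ (n<q^n d))))

  logq-≤ : ∀ {c} m → c ≤ q ^ℕ m → logq c ≤ m
  logq-≤ {c} m c≤q^m with logSearch-spec c (upTo (suc c))
  ... | inj₁ logq≡0   = subst (_≤ m) (sym logq≡0) z≤n
  ... | inj₂ q^logq≡c = ℕ.≮⇒≥ λ m<logq →
    ℕ.<⇒≱ (ℕ.^-monoʳ-< q q≥2 m<logq) (subst (_≤ q ^ℕ m) (sym q^logq≡c) c≤q^m)

  count≡q^⇒dim≡ : {X : Pred n} {d : ℕ} → count X ≡ q ^ℕ d → dim X ≡ d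
  count≡q^⇒dim≡ {d = d} count≡q^d = trans (cong logq count≡q^d) (logq-q^ d)

  dim-span-≤ : (ws : List (Vecq n)) → dim (span ws) ≤ length ws
  dim-span-≤ ws = logq-≤ (length ws) (count-span-≤ ws)

  -- Orthogonal complements

  record PerpDecomposition (V : Pred n) : Set where
    field
      perp-perp⊆ : perp (perp V) ⊆ V
      complement : List (Vecq n)
      count≡     : count V ≡ q ^ℕ length complement
      split      : ∀ x → ∃ λ w → perp V w ≡ true × ∃ λ cs → x ≡ w +ᵥ lincomb cs complement

  slice : Pred (suc n) → Pred n
  slice V v = V (0# ∷ v)

  slice-isSubspace : {V : Pred (suc n)} → IsSubspace V → IsSubspace (slice V)
  slice-isSubspace {V = V} V-sub =
      0∈ V-sub
    , (λ u v Vu Vv → ∈-resp-≡ V (cong (_∷ (u +ᵥ v)) (+-identityˡ 0#)) (+∈ V-sub Vu Vv))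
    , (λ a v Vv → ∈-resp-≡ V (cong (_∷ (a ·ᵥ v)) (zeroʳ a)) (·∈ V-sub a Vv))

  lincomb-map-0∷ : ∀ cs (L : List (Vecq n)) → lincomb cs (map (0# ∷_) L) ≡ 0# ∷ lincomb cs L
  lincomb-map-0∷ []       L       = refl
  lincomb-map-0∷ (c ∷ cs) []      = refl
  lincomb-map-0∷ (c ∷ cs) (w ∷ L) =
    trans (cong ((c ·ᵥ (0# ∷ w)) +ᵥ_) (lincomb-map-0∷ cs L))
          (cong (_∷ ((c ·ᵥ w) +ᵥ lincomb cs L)) (trans (cong (_+ 0#) (zeroʳ c)) (+-identityˡ 0#)))

  -- If (1, u) ∈ V, the slice of V at height x is slice V translated by x u.
  module Pivot {V : Pred (suc n)} (V-sub : IsSubspace V) (IH : PerpDecomposition (slice V))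
               (u : Vecq n) (V1u : V (1# ∷ u) ≡ true) where
    open PerpDecomposition IH renaming (complement to L′)
    open ≡-Reasoning

    ∈V⇒∈slice : ∀ x v → V (x ∷ v) ≡ true → slice V (v +ᵥ ((- x) ·ᵥ u)) ≡ true
    ∈V⇒∈slice x v Vxv =
      ∈-resp-≡ V (cong (_∷ (v +ᵥ ((- x) ·ᵥ u))) (trans (cong (x +_) (*-identityʳ (- x))) (-‿inverseʳ x)))
        (+∈ V-sub Vxv (·∈ V-sub (- x) V1u))

    ∈slice⇒∈V : ∀ x v → slice V (v +ᵥ ((- x) ·ᵥ u)) ≡ true → V (x ∷ v) ≡ true
    ∈slice⇒∈V x v Vv-xu = ∈-resp-≡ V (cong₂ _∷_ (trans (+-identityˡ _) (*-identityʳ x)) (begin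
        (v +ᵥ ((- x) ·ᵥ u)) +ᵥ (x ·ᵥ u) ≡⟨ +ᵥ-assoc v _ _ ⟩
        v +ᵥ (((- x) ·ᵥ u) +ᵥ (x ·ᵥ u)) ≡⟨ cong (v +ᵥ_) (·ᵥ-distribʳ (- x) x u) ⟨
        v +ᵥ ((- x + x) ·ᵥ u)           ≡⟨ cong (λ c → v +ᵥ (c ·ᵥ u)) (-‿inverseˡ x) ⟩
        v +ᵥ (0# ·ᵥ u)                  ≡⟨ cong (v +ᵥ_) (·ᵥ-zeroˡ u) ⟩
        v +ᵥ zeroV                      ≡⟨ +ᵥ-identityʳ v ⟩
        v                               ∎))
      (+∈ V-sub Vv-xu (·∈ V-sub x V1u))

    perp-lift : ∀ w → perp (slice V) w ≡ true → perp V ((- dot w u) ∷ w) ≡ true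
    perp-lift w w⊥ = ∈perp⁺ V ((- dot w u) ∷ w) λ { (x ∷ v) Vxv → begin
        (- dot w u) * x + dot w v         ≡⟨ cong (_+ dot w v) (-a*x≡-x*a (dot w u) x) ⟩
        (- x) * dot w u + dot w v         ≡⟨ +-comm _ _ ⟩
        dot w v + (- x) * dot w u         ≡⟨ cong (dot w v +_) (dot-·ʳ (- x) w u) ⟨
        dot w v + dot w ((- x) ·ᵥ u)      ≡⟨ dot-+ʳ w v _ ⟨
        dot w (v +ᵥ ((- x) ·ᵥ u))         ≡⟨ ∈perp⁻ (slice V) w w⊥ _ (∈V⇒∈slice x v Vxv) ⟩
        0#                                ∎ }

    perp-perp⊆′ : perp (perp V) ⊆ V
    perp-perp⊆′ (z ∷ t) z∷t∈ = ∈slice⇒∈V z t (perp-perp⊆ t-zu (∈perp⁺ (perp (slice V)) t-zu λ w w⊥ → begin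
        dot (t +ᵥ ((- z) ·ᵥ u)) w     ≡⟨ dot-+ˡ t _ w ⟩
        dot t w + dot ((- z) ·ᵥ u) w  ≡⟨ cong (dot t w +_) (dot-·ˡ (- z) u w) ⟩
        dot t w + (- z) * dot u w     ≡⟨ +-comm _ _ ⟩
        (- z) * dot u w + dot t w     ≡⟨ cong (λ c → (- z) * c + dot t w) (dot-comm u w) ⟩
        (- z) * dot w u + dot t w     ≡⟨ cong (_+ dot t w) (trans (-a*x≡-x*a z (dot w u)) (*-comm _ z)) ⟩
        z * (- dot w u) + dot t w     ≡⟨ ∈perp⁻ (perp V) (z ∷ t) z∷t∈ ((- dot w u) ∷ w) (perp-lift w w⊥) ⟩
        0#                            ∎))
      where
      t-zu : Vecq n
      t-zu = t +ᵥ ((- z) ·ᵥ u)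

    complement′ : List (Vecq (suc n))
    complement′ = (1# ∷ zeroV) ∷ map (0# ∷_) L′

    count≡′ : count V ≡ q ^ℕ length complement′
    count≡′ = begin
      count V                                                ≡⟨ count-∷ V ⟩
      sum (map (λ x → count (λ v → V (x ∷ v))) elements)    ≡⟨ sum-map-const _ slice≡ elements ⟩
      q *ℕ count (slice V)                                   ≡⟨ cong (q *ℕ_) count≡ ⟩
      q *ℕ q ^ℕ length L′                                    ≡⟨ cong (λ k → q *ℕ q ^ℕ k) (length-map (0# ∷_) L′) ⟨
      q ^ℕ length complement′                                ∎
      where
      slice≡ : ∀ x → count (λ v → V (x ∷ v)) ≡ count (slice V)
      slice≡ x = trans (count-cong λ v → Bool-ext (∈V⇒∈slice x v) (∈slice⇒∈V x v))
                       (count-translate (slice V) ((- x) ·ᵥ u))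

    split′ : ∀ x → ∃ λ w → perp V w ≡ true × ∃ λ cs → x ≡ w +ᵥ lincomb cs complement′
    split′ (y ∷ x′) with split x′
    ... | w′ , w′⊥ , cs , x′≡ = (- a) ∷ w′ , perp-lift w′ w′⊥ , (y + a) ∷ cs , sym (begin
        ((- a) ∷ w′) +ᵥ lincomb ((y + a) ∷ cs) complement′
          ≡⟨ cong (λ l → ((- a) ∷ w′) +ᵥ (((y + a) ·ᵥ (1# ∷ zeroV)) +ᵥ l)) (lincomb-map-0∷ cs L′) ⟩
        (- a + ((y + a) * 1# + 0#)) ∷ (w′ +ᵥ (((y + a) ·ᵥ zeroV) +ᵥ lincomb cs L′))
          ≡⟨ cong₂ _∷_ head≡ tail≡ ⟩
        y ∷ x′ ∎)
      where
      a : Carrier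
      a = dot w′ u
      head≡ : - a + ((y + a) * 1# + 0#) ≡ y
      head≡ = trans (cong (- a +_) (trans (+-identityʳ _) (*-identityʳ _)))
                    (trans (+-comm (- a) (y + a)) (+-//-rightDividesʳ a y))
      tail≡ : w′ +ᵥ (((y + a) ·ᵥ zeroV) +ᵥ lincomb cs L′) ≡ x′
      tail≡ = trans (cong (w′ +ᵥ_) (trans (cong (_+ᵥ lincomb cs L′) (·ᵥ-zeroʳ (y + a))) (+ᵥ-identityˡ _)))
                    (sym x′≡)

    decomposition : PerpDecomposition V
    decomposition = record
      { perp-perp⊆ = perp-perp⊆′ ; complement = complement′ ; count≡ = count≡′ ; split = split′ }

  module NoPivot {V : Pred (suc n)} (V-sub : IsSubspace V) (IH : PerpDecomposition (slice V))
                 (no-pivot : ∀ u → V (1# ∷ u) ≢ true) where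
    open PerpDecomposition IH renaming (complement to L′)
    open ≡-Reasoning

    head≡0 : ∀ x v → V (x ∷ v) ≡ true → x ≡ 0#
    head≡0 x v Vxv with x ≟ 0#
    ... | yes x≡0 = x≡0
    ... | no x≢0  = let y , xy≡1 = inverse x x≢0 in
      ⊥-elim (no-pivot (y ·ᵥ v) (∈-resp-≡ V (cong (_∷ (y ·ᵥ v)) (trans (*-comm y x) xy≡1)) (·∈ V-sub y Vxv)))

    ∈V⇒∈slice : ∀ x v → V (x ∷ v) ≡ true → slice V v ≡ true
    ∈V⇒∈slice x v Vxv = ∈-resp-≡ V (cong (_∷ v) (head≡0 x v Vxv)) Vxv

    perp-lift : ∀ y w → perp (slice V) w ≡ true → perp V (y ∷ w) ≡ true
    perp-lift y w w⊥ = ∈perp⁺ V (y ∷ w) λ { (x ∷ v) Vxv →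
      trans (cong₂ _+_ (trans (cong (y *_) (head≡0 x v Vxv)) (zeroʳ y)) (∈perp⁻ (slice V) w w⊥ v (∈V⇒∈slice x v Vxv)))
            (+-identityˡ 0#) }

    perp-perp⊆′ : perp (perp V) ⊆ V
    perp-perp⊆′ (z ∷ t) z∷t∈ = ∈-resp-≡ V (cong (_∷ t) (sym z≡0))
      (perp-perp⊆ t (∈perp⁺ (perp (slice V)) t λ w w⊥ → begin
        dot t w           ≡⟨ +-identityˡ _ ⟨
        0# + dot t w      ≡⟨ cong (_+ dot t w) (zeroʳ z) ⟨
        z * 0# + dot t w  ≡⟨ ∈perp⁻ (perp V) (z ∷ t) z∷t∈ (0# ∷ w) (perp-lift 0# w w⊥) ⟩
        0#                ∎))
      where
      z≡0 : z ≡ 0#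
      z≡0 = begin
        z                    ≡⟨ *-identityʳ z ⟨
        z * 1#               ≡⟨ +-identityʳ _ ⟨
        z * 1# + 0#          ≡⟨ cong (z * 1# +_) (dot-zeroʳ t) ⟨
        z * 1# + dot t zeroV ≡⟨ ∈perp⁻ (perp V) (z ∷ t) z∷t∈ (1# ∷ zeroV)
                                  (perp-lift 1# zeroV (0∈ (perp-isSubspace (slice V)))) ⟩
        0#                   ∎

    complement′ : List (Vecq (suc n))
    complement′ = map (0# ∷_) L′

    count≡′ : count V ≡ q ^ℕ length complement′
    count≡′ = begin
      count V                                                ≡⟨ count-∷ V ⟩
      sum (map (λ x → count (λ v → V (x ∷ v))) elements)    ≡⟨ sum-map-supported-at-0 _ empty-slice ⟩
      count (slice V)                                        ≡⟨ count≡ ⟩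
      q ^ℕ length L′                                         ≡⟨ cong (q ^ℕ_) (length-map (0# ∷_) L′) ⟨
      q ^ℕ length complement′                                ∎
      where
      empty-slice : ∀ x → x ≢ 0# → count (λ v → V (x ∷ v)) ≡ 0
      empty-slice x x≢0 = count-none _ λ v → ¬-not (x≢0 ∘ head≡0 x v)

    split′ : ∀ x → ∃ λ w → perp V w ≡ true × ∃ λ cs → x ≡ w +ᵥ lincomb cs complement′
    split′ (y ∷ x′) with split x′
    ... | w′ , w′⊥ , cs , x′≡ = y ∷ w′ , perp-lift y w′ w′⊥ , cs ,
      sym (trans (cong ((y ∷ w′) +ᵥ_) (lincomb-map-0∷ cs L′)) (cong₂ _∷_ (+-identityʳ y) (sym x′≡)))

    decomposition : PerpDecomposition V
    decomposition = record
      { perp-perp⊆ = perp-perp⊆′ ; complement = complement′ ; count≡ = count≡′ ; split = split′ }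

  perpDecomposition : {V : Pred n} → IsSubspace V → PerpDecomposition V
  perpDecomposition {zero} {V} V-sub = record
    { perp-perp⊆ = λ { [] _ → 0∈ V-sub }
    ; complement = []
    ; count≡     = count≡1 (0∈ V-sub)
    ; split      = λ { [] → [] , ∈perp⁺ V [] (λ { [] _ → refl }) , [] , refl }
    }
    where
    count≡1 : V [] ≡ true → count V ≡ 1
    count≡1 V[] rewrite V[] = refl
  perpDecomposition {suc n} {V} V-sub with any (λ u → V (1# ∷ u)) (allVecs n) in has-pivot
  ... | true  = let u , _ , V1u = any-true⁻ _ (allVecs n) has-pivot in
                Pivot.decomposition V-sub (perpDecomposition (slice-isSubspace V-sub)) u V1u
  ... | false = NoPivot.decomposition V-sub (perpDecomposition (slice-isSubspace V-sub))
                  λ u V1u → true≢false (any-true⁺ _ (allVecs-complete u) V1u) has-pivot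

  perp-perp≐ : {V : Pred n} → IsSubspace V → perp (perp V) ≐ V
  perp-perp≐ {V = V} V-sub = PerpDecomposition.perp-perp⊆ (perpDecomposition V-sub) , ⊆-perp-perp V

  zeroSpace : Pred n
  zeroSpace v = eqVᵇ v zeroV

  zeroSpace-isSubspace : IsSubspace (zeroSpace {n})
  zeroSpace-isSubspace = eqVᵇ⁺ refl
    , (λ u v u≡0 v≡0 → eqVᵇ⁺ (trans (cong₂ _+ᵥ_ (eqVᵇ⁻ u≡0) (eqVᵇ⁻ v≡0)) (+ᵥ-identityˡ zeroV)))
    , (λ a v v≡0 → eqVᵇ⁺ (trans (cong (a ·ᵥ_) (eqVᵇ⁻ v≡0)) (·ᵥ-zeroʳ a)))

  perp-full⊆zero : {v : Vecq n} → perp full v ≡ true → v ≡ zeroV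
  perp-full⊆zero {v = v} v⊥ = eqVᵇ⁻ (proj₁ (perp-perp≐ zeroSpace-isSubspace) v
    (perp-antitone {X = perp zeroSpace} (λ _ _ → refl) v v⊥))

  normalized⇒≢zero : (v : Vecq n) → normalized v ≡ true → v ≢ zeroV
  normalized⇒≢zero (x ∷ v) nv v≡0 with eqᵇ x 0# in x≡ᵇ0
  ... | true  = normalized⇒≢zero v nv (Vecₚ.∷-injectiveʳ v≡0)
  ... | false = true≢false (eqᵇ⁺ (Vecₚ.∷-injectiveˡ v≡0)) x≡ᵇ0

  normalized-0∷ : {p : Vecq n} → normalized p ≡ true → normalized (0# ∷ p) ≡ true
  normalized-0∷ np rewrite eqᵇ⁺ {0#} refl = np

  normalized-1∷ : (v : Vecq n) → normalized (1# ∷ v) ≡ true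
  normalized-1∷ v rewrite eqᵇ-false (0≢1 ∘ sym) = eqᵇ⁺ refl

  normalize : (v : Vecq n) → v ≢ zeroV →
              ∃ λ p → normalized p ≡ true × (∃ λ a → v ≡ a ·ᵥ p) × (∃ λ a → p ≡ a ·ᵥ v)
  normalize [] v≢0 = ⊥-elim (v≢0 refl)
  normalize (x ∷ v) x∷v≢0 with x ≟ 0#
  ... | yes refl =
    let p , np , (a , v≡ap) , (a′ , p≡a′v) = normalize v (x∷v≢0 ∘ cong (0# ∷_)) in
    0# ∷ p , normalized-0∷ {p = p} np
    , (a , cong₂ _∷_ (sym (zeroʳ a)) v≡ap) , (a′ , cong₂ _∷_ (sym (zeroʳ a′)) p≡a′v)
  ... | no x≢0 =
    let y , xy≡1 = inverse x x≢0 in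
    y ·ᵥ (x ∷ v)
    , subst (λ c → normalized (c ∷ (y ·ᵥ v)) ≡ true) (sym (trans (*-comm y x) xy≡1)) (normalized-1∷ (y ·ᵥ v))
    , (x , sym (trans (·ᵥ-assoc x y (x ∷ v)) (trans (cong (_·ᵥ (x ∷ v)) xy≡1) (·ᵥ-identityˡ (x ∷ v)))))
    , (y , refl)

  ∈points⁺ : {p : Vecq n} → normalized p ≡ true → p ∈ points n
  ∈points⁺ np = ∈-filterᵇ⁺ normalized (allVecs-complete _) np

  ∈points⁻ : {p : Vecq n} → p ∈ points n → normalized p ≡ true
  ∈points⁻ {n} p∈ = proj₂ (∈-filterᵇ⁻ normalized (allVecs n) p∈)

  ⊆-fromPoints : {X Y : Pred n} → IsSubspace X → IsSubspace Y →
                 (∀ p → normalized p ≡ true → X p ≡ true → Y p ≡ true) → X ⊆ Y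
  ⊆-fromPoints {X = X} {Y} X-sub Y-sub X⊆Y v Xv with Vecₚ.≡-dec _≟_ v zeroV
  ... | yes refl = 0∈ Y-sub
  ... | no v≢0   = let p , np , (a , v≡ap) , (a′ , p≡a′v) = normalize v v≢0 in
    ∈-resp-≡ Y (sym v≡ap) (·∈ Y-sub a (X⊆Y p np (∈-resp-≡ X (sym p≡a′v) (·∈ X-sub a′ Xv))))

  ⟨⟩-isSubspace : (T : Pred n) → IsSubspace ⟨ T ⟩
  ⟨⟩-isSubspace {n} T = span-isSubspace (filterᵇ T (points n))

  point∈⟨⟩ : (T : Pred n) {p : Vecq n} → normalized p ≡ true → T p ≡ true → ⟨ T ⟩ p ≡ true
  point∈⟨⟩ {n} T np Tp = ∈span-member (filterᵇ T (points n)) (∈-filterᵇ⁺ T (∈points⁺ np) Tp)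

  ⟨⟩-least : (T : Pred n) {X : Pred n} → IsSubspace X →
             (∀ p → normalized p ≡ true → T p ≡ true → X p ≡ true) → ⟨ T ⟩ ⊆ X
  ⟨⟩-least {n} T X-sub T⊆X = span-least X-sub (filterᵇ T (points n)) λ w w∈ →
    let w∈points , Tw = ∈-filterᵇ⁻ T (points n) w∈ in T⊆X w (∈points⁻ w∈points) Tw

  ⟨⟩≐ : (T : Pred n) {W : Pred n} → IsSubspace W → (∀ p → normalized p ≡ true → T p ≡ W p) → ⟨ T ⟩ ≐ W
  ⟨⟩≐ T W-sub T≗W = ⟨⟩-least T W-sub (λ p np Tp → trans (sym (T≗W p np)) Tp)
                   , ⊆-fromPoints W-sub (⟨⟩-isSubspace T) (λ p np Wp → point∈⟨⟩ T np (trans (T≗W p np) Wp))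

  -- Dual nullities of M and of Cl(M)

  module Nullities {n : ℕ} (M : QMatroid n) where
    open QMatroid M
    module Cl = FinMatroid (points n) (ClRank M)

    ρ-⊕-≤ : {X Y : Pred n} → IsSubspace X → IsSubspace Y → ρ (X ⊕ Y) ≤ ρ X +ℕ ρ Y
    ρ-⊕-≤ {X} {Y} X-sub Y-sub = ℕ.≤-trans (ℕ.m≤m+n _ _) (ρ-sub X Y X-sub Y-sub)

    ρ-span-≤ : (ws : List (Vecq n)) → ρ (span ws) ≤ length ws
    ρ-span-≤ ws = ℕ.≤-trans (ρ-bound _ (span-isSubspace ws)) (dim-span-≤ ws)

    ρ-full-≤ : {X : Pred n} (ws : List (Vecq n)) → IsSubspace X → full ⊆ (X ⊕ span ws) →
               ρ full ≤ length ws +ℕ ρ X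
    ρ-full-≤ {X} ws X-sub full⊆ = begin
      ρ full               ≤⟨ ρ-mono full _ full-isSubspace (⊕-isSubspace X-sub (span-isSubspace ws)) full⊆ ⟩
      ρ (X ⊕ span ws)      ≤⟨ ρ-⊕-≤ X-sub (span-isSubspace ws) ⟩
      ρ X +ℕ ρ (span ws)   ≤⟨ ℕ.+-monoʳ-≤ (ρ X) (ρ-span-≤ ws) ⟩
      ρ X +ℕ length ws     ≡⟨ ℕ.+-comm (ρ X) (length ws) ⟩
      length ws +ℕ ρ X     ∎
      where open ℕ.≤-Reasoning

    -- The truncated subtractions in η* are exact: ρ(V^⊥) ≤ ρ(E) ≤ dim V + ρ(V^⊥).
    η*≡ρ-full∸ρ-perp : {V : Pred n} → IsSubspace V → η* M V ≡ ρ full ∸ ρ (perp V)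
    η*≡ρ-full∸ρ-perp {V} V-sub = m∸[[m+n]∸o]≡o∸n (dim V) (ρ (perp V)) (ρ full)
      (ρ-mono _ _ (perp-isSubspace V) full-isSubspace (λ _ _ → refl))
      (subst (λ d → ρ full ≤ d +ℕ ρ (perp V)) (sym (count≡q^⇒dim≡ {X = V} count≡))
        (ρ-full-≤ complement (perp-isSubspace V) λ x _ → let w , w⊥V , cs , x≡ = split x in
          ∈-resp-≡ (perp V ⊕ span complement) (sym x≡)
            (∈⊕⁺ (perp V) (span complement) w⊥V (∈span-lincomb complement cs))))
      where open PerpDecomposition (perpDecomposition V-sub)

    η*-cong : {X Y : Pred n} → IsSubspace X → IsSubspace Y → X ≐ Y → η* M X ≡ η* M Y
    η*-cong {X} {Y} X-sub Y-sub (X⊆Y , Y⊆X) = cong₂ (λ d r → d ∸ ((d +ℕ r) ∸ ρ full)) dim≡ ρ-perp≡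
      where
      dim≡ : dim X ≡ dim Y
      dim≡ = cong logq (count-cong λ v → Bool-ext (X⊆Y v) (Y⊆X v))
      ρ-perp≡ : ρ (perp X) ≡ ρ (perp Y)
      ρ-perp≡ = ρ-ext _ _ (perp-isSubspace X) (perp-isSubspace Y) (perp-antitone Y⊆X , perp-antitone X⊆Y)

    ClRank-all : ClRank M (λ _ → true) ≡ ρ full
    ClRank-all = ρ-ext _ _ (⟨⟩-isSubspace _) full-isSubspace (⟨⟩≐ _ full-isSubspace λ _ _ → refl)

    ρ-full-≤-card+ClRank : (Y : Pred n) → ρ full ≤ Cl.card Y +ℕ ClRank M (∁ Y)
    ρ-full-≤-card+ClRank Y = ρ-full-≤ Yp (⟨⟩-isSubspace (∁ Y))
      (⊆-fromPoints full-isSubspace (⊕-isSubspace (⟨⟩-isSubspace (∁ Y)) (span-isSubspace Yp)) λ p np _ → point∈ p np)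
      where
      Yp : List (Vecq n)
      Yp = filterᵇ Y (points n)
      point∈ : ∀ p → normalized p ≡ true → (⟨ ∁ Y ⟩ ⊕ span Yp) p ≡ true
      point∈ p np with Y p in Yp≡
      ... | true  = ∈-resp-≡ (⟨ ∁ Y ⟩ ⊕ span Yp) (+ᵥ-identityˡ p)
                      (∈⊕⁺ ⟨ ∁ Y ⟩ (span Yp) (0∈ (⟨⟩-isSubspace (∁ Y)))
                        (∈span-member Yp (∈-filterᵇ⁺ Y (∈points⁺ np) Yp≡)))
      ... | false = ∈-resp-≡ (⟨ ∁ Y ⟩ ⊕ span Yp) (+ᵥ-identityʳ p)
                      (∈⊕⁺ ⟨ ∁ Y ⟩ (span Yp) (point∈⟨⟩ (∁ Y) np (not-true⁺ Yp≡)) (0∈ (span-isSubspace Yp)))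

    Cl-nullity*≡ : (Y : Pred n) → Cl.nullity* Y ≡ ρ full ∸ ClRank M (∁ Y)
    Cl-nullity*≡ Y = begin
      Cl.nullity* Y                                             ≡⟨ cong (λ r → c ∸ ((c +ℕ ClRank M (∁ Y)) ∸ r)) ClRank-all ⟩
      c ∸ ((c +ℕ ClRank M (∁ Y)) ∸ ρ full)                      ≡⟨ m∸[[m+n]∸o]≡o∸n c _ _
                                                                     (ρ-mono _ _ (⟨⟩-isSubspace _) full-isSubspace (λ _ _ → refl))
                                                                     (ρ-full-≤-card+ClRank Y) ⟩
      ρ full ∸ ClRank M (∁ Y)                                   ∎
      where
      open ≡-Reasoning
      c : ℕ
      c = Cl.card Y

  qCyclesIn : QMatroid n → Pred n → Poset'
  qCyclesIn M U = record
    { Carrier = Σ (Pred _) (λ V → IsQCycleDual M V × V ⊆ U) ; _⊑_ = λ V W → proj₁ V ⊆ proj₁ W }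

  ClCyclesIn : QMatroid n → Pred n → Poset'
  ClCyclesIn {n} M R = record
    { Carrier = Σ (Pred n) (λ Y → Cl.IsCycleDual Y × Y Cl.⊆G R) ; _⊑_ = λ Y Z → proj₁ Y Cl.⊆G proj₁ Z }
    where module Cl = FinMatroid (points n) (ClRank M)

  qCycles : QMatroid n → Poset'
  qCycles {n} M = record { Carrier = Σ (Pred n) (IsQCycleDual M) ; _⊑_ = λ V W → proj₁ V ⊆ proj₁ W }

  ClCycles : QMatroid n → Poset'
  ClCycles {n} M = record { Carrier = Σ (Pred n) Cl.IsCycleDual ; _⊑_ = λ Y Z → proj₁ Y Cl.⊆G proj₁ Z }
    where module Cl = FinMatroid (points n) (ClRank M)

  -- P(E) ∖ P(V^⊥), as a predicate on normalized representatives.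
  offPerp : Pred n → Pred n
  offPerp V = ∁ (perp V)

  module Correspondence {n : ℕ} (M : QMatroid n) where
    open QMatroid M
    open Nullities M

    perp⟨∁_⟩ : Pred n → Pred n
    perp⟨∁ Y ⟩ = perp ⟨ ∁ Y ⟩

    perp-cong : {X Y : Pred n} → X ≐ Y → perp X ≐ perp Y
    perp-cong (X⊆Y , Y⊆X) = perp-antitone Y⊆X , perp-antitone X⊆Y

    ⟨∁offPerp⟩≐perp : (V : Pred n) → ⟨ ∁ (offPerp V) ⟩ ≐ perp V
    ⟨∁offPerp⟩≐perp V = ⟨⟩≐ _ (perp-isSubspace V) λ p _ → not-involutive (perp V p)

    offPerp-mono : {V W : Pred n} → V ⊆ W → offPerp V Cl.⊆G offPerp W
    offPerp-mono V⊆W a _ a∉V⊥ =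
      not-true⁺ (¬-not λ a∈W⊥ → true≢false (perp-antitone V⊆W a a∈W⊥) (not-true⁻ a∉V⊥))

    perp⟨∁⟩-mono : {Y Z : Pred n} → Y Cl.⊆G Z → perp⟨∁ Y ⟩ ⊆ perp⟨∁ Z ⟩
    perp⟨∁⟩-mono {Y} {Z} Y⊆Z = perp-antitone (⟨⟩-least (∁ Z) (⟨⟩-isSubspace (∁ Y)) λ p np p∉Z →
      point∈⟨⟩ (∁ Y) np (not-true⁺ (¬-not λ p∈Y → true≢false (Y⊆Z p (∈points⁺ np) p∈Y) (not-true⁻ p∉Z))))

    perp⟨∁⟩-offPerp : {V : Pred n} → IsSubspace V → perp⟨∁ offPerp V ⟩ ≐ V
    perp⟨∁⟩-offPerp {V} V-sub =
      let (⊆V⊥⊥ , V⊥⊥⊆) = perp-cong (⟨∁offPerp⟩≐perp V) ; (V⊥⊥⊆V , V⊆V⊥⊥) = perp-perp≐ V-sub in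
      ⊆-trans ⊆V⊥⊥ V⊥⊥⊆V , ⊆-trans V⊆V⊥⊥ V⊥⊥⊆

    offPerp-perp⟨∁⟩⊆ : (Y : Pred n) → offPerp perp⟨∁ Y ⟩ Cl.⊆G Y
    offPerp-perp⟨∁⟩⊆ Y a a∈ a∉ = ¬-not λ Ya≡false →
      true≢false (⊆-perp-perp _ a (point∈⟨⟩ (∁ Y) (∈points⁻ a∈) (not-true⁺ Ya≡false))) (not-true⁻ a∉)

    Cl-nullity*-offPerp : {V : Pred n} → IsSubspace V → Cl.nullity* (offPerp V) ≡ η* M V
    Cl-nullity*-offPerp {V} V-sub = begin
      Cl.nullity* (offPerp V)              ≡⟨ Cl-nullity*≡ (offPerp V) ⟩
      ρ full ∸ ρ ⟨ ∁ (offPerp V) ⟩         ≡⟨ cong (ρ full ∸_) (ρ-ext _ _ (⟨⟩-isSubspace _) (perp-isSubspace V)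
                                                                     (⟨∁offPerp⟩≐perp V)) ⟩
      ρ full ∸ ρ (perp V)                  ≡⟨ η*≡ρ-full∸ρ-perp V-sub ⟨
      η* M V                               ∎
      where open ≡-Reasoning

    η*-perp⟨∁⟩ : (Y : Pred n) → η* M perp⟨∁ Y ⟩ ≡ Cl.nullity* Y
    η*-perp⟨∁⟩ Y = begin
      η* M perp⟨∁ Y ⟩                      ≡⟨ η*≡ρ-full∸ρ-perp (perp-isSubspace _) ⟩
      ρ full ∸ ρ (perp (perp ⟨ ∁ Y ⟩))     ≡⟨ cong (ρ full ∸_) (ρ-ext _ _ (perp-isSubspace _) (⟨⟩-isSubspace _)
                                                                     (perp-perp≐ (⟨⟩-isSubspace _))) ⟩
      ρ full ∸ ρ ⟨ ∁ Y ⟩                   ≡⟨ Cl-nullity*≡ Y ⟨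
      Cl.nullity* Y                        ∎
      where open ≡-Reasoning

    _∖_ : Pred n → Vecq n → Pred n
    (Y ∖ a) v = Y v ∧ not (eqVᵇ v a)

    ⟨∁∖⟩≐ : (Y : Pred n) {a : Vecq n} → ⟨ ∁ Y ⟩ a ≡ true → ⟨ ∁ (Y ∖ a) ⟩ ≐ ⟨ ∁ Y ⟩
    ⟨∁∖⟩≐ Y {a} a∈⟨∁Y⟩ =
        ⟨⟩-least (∁ (Y ∖ a)) (⟨⟩-isSubspace (∁ Y)) within
      , ⟨⟩-least (∁ Y) (⟨⟩-isSubspace (∁ (Y ∖ a))) λ p np p∉Y →
          point∈⟨⟩ (∁ (Y ∖ a)) np (not-true⁺ (cong (_∧ not (eqVᵇ p a)) (not-true⁻ p∉Y)))
      where
      within : ∀ p → normalized p ≡ true → ∁ (Y ∖ a) p ≡ true → ⟨ ∁ Y ⟩ p ≡ true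
      within p np p∉Y∖a with Y p in Yp | eqVᵇ p a in p≡ᵇa
      ... | false | _    = point∈⟨⟩ (∁ Y) np (not-true⁺ Yp)
      ... | true  | true = ∈-resp-≡ ⟨ ∁ Y ⟩ (sym (eqVᵇ⁻ p≡ᵇa)) a∈⟨∁Y⟩
      within p np () | true | false

    Cl-nullity*-cong : {Y Z : Pred n} → ⟨ ∁ Y ⟩ ≐ ⟨ ∁ Z ⟩ → Cl.nullity* Y ≡ Cl.nullity* Z
    Cl-nullity*-cong {Y} {Z} ⟨∁Y⟩≐⟨∁Z⟩ = trans (Cl-nullity*≡ Y)
      (trans (cong (ρ full ∸_) (ρ-ext _ _ (⟨⟩-isSubspace _) (⟨⟩-isSubspace _) ⟨∁Y⟩≐⟨∁Z⟩))
             (sym (Cl-nullity*≡ Z)))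

    -- Removing a point of Y that lies in ⟨P(E) ∖ Y⟩ would not change the nullity.
    cycle⊆offPerp : ∀ {i} {Y : Pred n} → Cl.IsCycleDualOfNullity i Y → Y Cl.⊆G offPerp perp⟨∁ Y ⟩
    cycle⊆offPerp {Y = Y} (nY≡i , minimal) a a∈ Ya = not-true⁺ (¬-not λ a∈⊥⊥ →
      let a∈⟨∁Y⟩ = proj₁ (perp-perp≐ (⟨⟩-isSubspace (∁ Y))) a a∈⊥⊥ in
      minimal (Y ∖ a) ((λ v _ → proj₁ ∘ ∧-true⁻) , λ Y⊆Y∖a →
          true≢false (eqVᵇ⁺ {u = a} refl) (not-true⁻ (proj₂ (∧-true⁻ (Y⊆Y∖a a a∈ Ya)))))
        (trans (Cl-nullity*-cong (⟨∁∖⟩≐ Y a∈⟨∁Y⟩)) nY≡i))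

    module _ {U : Pred n} (U-sub : IsSubspace U) where

      toCl : Poset'.Carrier (qCyclesIn M U) → Poset'.Carrier (ClCyclesIn M (offPerp U))
      toCl (V , (i , V-sub , ηV≡i , minimal) , V⊆U) =
        offPerp V , (i , trans (Cl-nullity*-offPerp V-sub) ηV≡i , minimal′) , offPerp-mono V⊆U
        where
        minimal′ : ∀ Z → Z Cl.⊂G offPerp V → Cl.nullity* Z ≢ i
        minimal′ Z (Z⊆ , ⊉Z) nZ≡i = minimal perp⟨∁ Z ⟩ (perp-isSubspace _)
          ( ⊆-trans (perp⟨∁⟩-mono Z⊆) (proj₁ (perp⟨∁⟩-offPerp V-sub))
          , λ V⊆ → ⊉Z (⊆G-trans {r = ClRank M} (offPerp-mono V⊆) (offPerp-perp⟨∁⟩⊆ Z)))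
          (trans (η*-perp⟨∁⟩ Z) nZ≡i)

      fromCl : Poset'.Carrier (ClCyclesIn M (offPerp U)) → Poset'.Carrier (qCyclesIn M U)
      fromCl (Y , (i , nY≡i , minimal) , Y⊆R) =
        perp⟨∁ Y ⟩ , (i , perp-isSubspace _ , trans (η*-perp⟨∁⟩ Y) nY≡i , minimal′)
        , ⊆-trans (perp⟨∁⟩-mono Y⊆R) (proj₁ (perp⟨∁⟩-offPerp U-sub))
        where
        minimal′ : ∀ W → IsSubspace W → W ⊂ perp⟨∁ Y ⟩ → η* M W ≢ i
        minimal′ W W-sub (W⊆ , ⊉W) ηW≡i = minimal (offPerp W)
          ( ⊆G-trans {r = ClRank M} (offPerp-mono W⊆) (offPerp-perp⟨∁⟩⊆ Y)
          , λ Y⊆ → ⊉W (⊆-trans (perp⟨∁⟩-mono Y⊆) (proj₁ (perp⟨∁⟩-offPerp W-sub))))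
          (trans (Cl-nullity*-offPerp W-sub) ηW≡i)

      qCyclesIn≅ClCyclesIn : OrderIso (qCyclesIn M U) (ClCyclesIn M (offPerp U))
      qCyclesIn≅ClCyclesIn = record
        { to      = toCl
        ; from    = fromCl
        ; to-mono = λ _ _ → offPerp-mono
        ; to-refl = λ { (V , (_ , V-sub , _) , _) (W , (_ , W-sub , _) , _) V⊆W →
            ⊆-trans (proj₂ (perp⟨∁⟩-offPerp V-sub))
                    (⊆-trans (perp⟨∁⟩-mono V⊆W) (proj₁ (perp⟨∁⟩-offPerp W-sub))) }
        ; from-to = λ { (V , (_ , V-sub , _) , _) → perp⟨∁⟩-offPerp V-sub }
        ; to-from = λ { (Y , (_ , Y-cycle) , _) → offPerp-perp⟨∁⟩⊆ Y , cycle⊆offPerp Y-cycle }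
        }

  qCycles≅qCyclesIn-full : (M : QMatroid n) → OrderIso (qCycles M) (qCyclesIn M full)
  qCycles≅qCyclesIn-full M = record
    { to      = λ { (V , V-cycle) → V , V-cycle , (λ _ _ → refl) }
    ; from    = λ { (V , V-cycle , _) → V , V-cycle }
    ; to-mono = λ _ _ V⊆W → V⊆W
    ; to-refl = λ _ _ V⊆W → V⊆W
    ; from-to = λ _ → (λ _ Vv → Vv) , (λ _ Vv → Vv)
    ; to-from = λ _ → (λ _ Vv → Vv) , (λ _ Vv → Vv)
    }

  ClCyclesIn-offPerp-full≅ClCycles : (M : QMatroid n) → OrderIso (ClCyclesIn M (offPerp full)) (ClCycles M)
  ClCyclesIn-offPerp-full≅ClCycles M = record
    { to      = λ { (Y , Y-cycle , _) → Y , Y-cycle }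
    ; from    = λ { (Y , Y-cycle) → Y , Y-cycle , (λ a a∈ _ → point∈offPerp-full a∈) }
    ; to-mono = λ _ _ Y⊆Z → Y⊆Z
    ; to-refl = λ _ _ Y⊆Z → Y⊆Z
    ; from-to = λ _ → (λ _ _ Ya → Ya) , (λ _ _ Ya → Ya)
    ; to-from = λ _ → (λ _ _ Ya → Ya) , (λ _ _ Ya → Ya)
    }
    where
    point∈offPerp-full : ∀ {a} → a ∈ points _ → offPerp full a ≡ true
    point∈offPerp-full {a} a∈ = not-true⁺ (¬-not (normalized⇒≢zero a (∈points⁻ a∈) ∘ perp-full⊆zero))

  qCycles≅ClCycles : (M : QMatroid n) → OrderIso (qCycles M) (ClCycles M)
  qCycles≅ClCycles M =
    OrderIso-trans ⊆-trans ⊆-trans (⊆G-trans {r = ClRank M}) (qCycles≅qCyclesIn-full M)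
      (OrderIso-trans ⊆-trans (⊆G-trans {r = ClRank M}) (⊆G-trans {r = ClRank M})
        (Correspondence.qCyclesIn≅ClCyclesIn M full-isSubspace) (ClCyclesIn-offPerp-full≅ClCycles M))

  -- Coordinates on U

  module Coordinates {n : ℕ} (M : QMatroid n) {U : Pred n} {b : List (Vecq n)} (basis : IsBasisOf b U)
                     (MU : QMatroid (length b))
                     (η*-MU : ∀ V → IsSubspace V → η* MU V ≡ η* M (image b V)) where
    open Nullities M using (η*-cong)

    private
      s : ℕ
      s = length b
      coord-kernel : ∀ c → coord b c ≡ zeroV → c ≡ zeroV
      coord-kernel = proj₁ basis
      coord-onto : ∀ v → U v ≡ true → ∃ λ c → coord b c ≡ v
      coord-onto = proj₁ (proj₂ basis)
      coord∈U : ∀ c → U (coord b c) ≡ true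
      coord∈U = proj₂ (proj₂ basis)

    preimage : Pred n → Pred s
    preimage V c = V (coord b c)

    preimage-isSubspace : {V : Pred n} → IsSubspace V → IsSubspace (preimage V)
    preimage-isSubspace {V} V-sub =
        ∈-resp-≡ V (sym (coord-zero b)) (0∈ V-sub)
      , (λ c d Vc Vd → ∈-resp-≡ V (sym (coord-+ b c d)) (+∈ V-sub Vc Vd))
      , (λ a c Vc → ∈-resp-≡ V (sym (coord-· b a c)) (·∈ V-sub a Vc))

    image-isSubspace : {W : Pred s} → IsSubspace W → IsSubspace (image b W)
    image-isSubspace {W} W-sub =
        ∈-resp-≡ (image b W) (coord-zero b) (∈image⁺ b W (0∈ W-sub))
      , (λ u v u∈ v∈ → let c , Wc , bc≡u = ∈image⁻ b W u∈ ; d , Wd , bd≡v = ∈image⁻ b W v∈ in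
           ∈-resp-≡ (image b W) (trans (coord-+ b c d) (cong₂ _+ᵥ_ bc≡u bd≡v)) (∈image⁺ b W (+∈ W-sub Wc Wd)))
      , (λ a v v∈ → let c , Wc , bc≡v = ∈image⁻ b W v∈ in
           ∈-resp-≡ (image b W) (trans (coord-· b a c) (cong (a ·ᵥ_) bc≡v)) (∈image⁺ b W (·∈ W-sub a Wc)))

    image-mono : {W W′ : Pred s} → W ⊆ W′ → image b W ⊆ image b W′
    image-mono {W} {W′} W⊆W′ v v∈ = let c , Wc , bc≡v = ∈image⁻ b W v∈ in
      ∈-resp-≡ (image b W′) bc≡v (∈image⁺ b W′ (W⊆W′ c Wc))

    image⊆U : (W : Pred s) → image b W ⊆ U
    image⊆U W v v∈ = let c , _ , bc≡v = ∈image⁻ b W v∈ in ∈-resp-≡ U bc≡v (coord∈U c)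

    image-preimage : {V : Pred n} → V ⊆ U → image b (preimage V) ≐ V
    image-preimage {V} V⊆U =
        (λ v v∈ → let c , Vbc , bc≡v = ∈image⁻ b (preimage V) v∈ in ∈-resp-≡ V bc≡v Vbc)
      , (λ v Vv → let c , bc≡v = coord-onto v (V⊆U v Vv) in
           ∈-resp-≡ (image b (preimage V)) bc≡v (∈image⁺ b (preimage V) {c} (∈-resp-≡ V (sym bc≡v) Vv)))

    coord-injective : ∀ c c′ → coord b c ≡ coord b c′ → c ≡ c′
    coord-injective c c′ bc≡bc′ = x∙y⁻¹≈ε⇒x≈y c c′
      (coord-kernel _ (trans (coord-ᵥ b c c′) (trans (cong (_-ᵥ coord b c′) bc≡bc′) (-ᵥ-self _))))

    preimage-image : (W : Pred s) → preimage (image b W) ≐ W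
    preimage-image W =
        (λ c c∈ → let c′ , Wc′ , bc′≡bc = ∈image⁻ b W c∈ in ∈-resp-≡ W (coord-injective c′ c bc′≡bc) Wc′)
      , (λ c Wc → ∈image⁺ b W Wc)

    toCoord : Poset'.Carrier (qCyclesIn M U) → Poset'.Carrier (qCycles MU)
    toCoord (V , (i , V-sub , ηV≡i , minimal) , V⊆U) =
      preimage V , i , preimage-isSubspace V-sub , η*-preimage , minimal′
      where
      η*-preimage : η* MU (preimage V) ≡ i
      η*-preimage = trans (η*-MU _ (preimage-isSubspace V-sub))
        (trans (η*-cong (image-isSubspace (preimage-isSubspace V-sub)) V-sub (image-preimage V⊆U)) ηV≡i)
      minimal′ : ∀ W → IsSubspace W → W ⊂ preimage V → η* MU W ≢ i
      minimal′ W W-sub (W⊆ , ⊉W) ηW≡i = minimal (image b W) (image-isSubspace W-sub)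
        ( ⊆-trans (image-mono W⊆) (proj₁ (image-preimage V⊆U))
        , λ V⊆ → ⊉W λ c Vbc → proj₁ (preimage-image W) c (V⊆ _ Vbc))
        (trans (sym (η*-MU W W-sub)) ηW≡i)

    fromCoord : Poset'.Carrier (qCycles MU) → Poset'.Carrier (qCyclesIn M U)
    fromCoord (W , i , W-sub , ηW≡i , minimal) =
      image b W , (i , image-isSubspace W-sub , trans (sym (η*-MU W W-sub)) ηW≡i , minimal′) , image⊆U W
      where
      minimal′ : ∀ X → IsSubspace X → X ⊂ image b W → η* M X ≢ i
      minimal′ X X-sub (X⊆ , ⊉X) ηX≡i = minimal (preimage X) (preimage-isSubspace X-sub)
        ( (λ c Xbc → proj₁ (preimage-image W) c (X⊆ _ Xbc))
        , λ W⊆ → ⊉X (⊆-trans (image-mono W⊆) (proj₁ (image-preimage X⊆U))))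
        (trans (η*-MU _ (preimage-isSubspace X-sub))
          (trans (η*-cong (image-isSubspace (preimage-isSubspace X-sub)) X-sub (image-preimage X⊆U)) ηX≡i))
        where
        X⊆U : X ⊆ U
        X⊆U = ⊆-trans X⊆ (image⊆U W)

    qCyclesIn≅qCycles : OrderIso (qCyclesIn M U) (qCycles MU)
    qCyclesIn≅qCycles = record
      { to      = toCoord
      ; from    = fromCoord
      ; to-mono = λ _ _ V⊆W c Vbc → V⊆W _ Vbc
      ; to-refl = λ { (V , _ , V⊆U) (W , _ , W⊆U) V⊆W →
          ⊆-trans (proj₂ (image-preimage V⊆U)) (⊆-trans (image-mono V⊆W) (proj₁ (image-preimage W⊆U))) }
      ; from-to = λ { (V , _ , V⊆U) → image-preimage V⊆U }
      ; to-from = λ { (W , _) → preimage-image W }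
      }

proposition5p10 : (F : FiniteField) → let open Over F in
    (n : ℕ) (M : QMatroid n) (U : Pred n) → IsQCycleDual M U →
    (b : _) → IsBasisOf b U →
    (MU : QMatroid (length b)) →
    (∀ V → IsSubspace V → η* MU V ≡ η* M (image b V)) →
    let open Posets M U b MU in
      OrderIso P1 P2 × OrderIso P1 P3 × OrderIso P1 P4
proposition5p10 F n M U (_ , U-sub , _) b basis MU η*-MU =
  P1≅P2 , OrderIso-trans ⊆-trans ⊆-trans (⊆G-trans {r = ClRank MU}) P1≅P2 (qCycles≅ClCycles MU) ,
  Correspondence.qCyclesIn≅ClCyclesIn M U-sub
  where
  open LinearAlgebra F
  P1≅P2 : OrderIso (qCyclesIn M U) (qCycles MU)
  P1≅P2 = Coordinates.qCyclesIn≅qCycles M basis MU η*-MU
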